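{- Let $k\ge 1$ and let $H$ be a $2k$-uniform hypergraph in which every vertex has even degree. Then $H$ is quasi-eulerian. Moreover, $H$ has a collection of Euler families $\{\mathcal{F}_1,\dots,\mathcal{F}_k\}$ such that each flag of $H$ is an anchor flag of exactly one family $\mathcal{F}_i$ in this collection.
   Context: A hypergraph $H=(V,E)$ has a nonempty finite vertex set $V$ and a finite set $E$ of edges, each associated with a subset of $V$ (parallel edges allowed). $H$ is $2k$-uniform if every edge has exactly $2k$ vertices; the degree of a vertex is the number of edges containing it. A flag is a pair $(v,e)$ with $v\in e$. A walk is $v_0e_1v_1\dots e_mv_m$ with $v_{i-1}\ne v_i$, $v_{i-1},v_i\in e_i$; its anchors are $v_0,\dots,v_m$ and its anchor flags are $(v_0,e_1),(v_1,e_1),(v_1,e_2),\dots,(v_{m-1},e_m),(v_m,e_m)$; it is closed if $m\ge2$ and $v_0=v_m$; a strict trail if $e_1,\dots,e_m$ are pairwise distinct. An Euler family is a family of pairwise anchor-disjoint closed strict trails such that each edge lies in exactly one of them; an anchor flag of a family is an anchor flag of one of its trails. $H$ is quasi-eulerian if it admits an Euler family. -}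

module Defs where

open import Data.Nat using (ℕ; zero; suc; _≤_; _*_)
open import Data.Nat.Divisibility using (_∣_)
open import Data.Fin using (Fin)
open import Data.Fin.Subset using (Subset; ∣_∣) renaming (_∈_ to _∈ₛ_)
open import Data.Vec using (tabulate; lookup)
open import Data.List using (List; []; _∷_; map; length)
import Data.List as L
open import Data.List.Membership.Propositional using () renaming (_∈_ to _∈ₗ_)
open import Data.List.Relation.Unary.Unique.Propositional using (Unique)
open import Data.List.Relation.Unary.All using (All)
open import Data.Product using (Σ; ∃; _×_; _,_; proj₁; proj₂)
open import Data.Unit using (⊤)
open import Relation.Binary.PropositionalEquality using (_≡_; _≢_)
open import Relation.Nullary using (¬_)

-- A finite hypergraph: vertices Fin nV (nonempty), edges Fin nE, each edge
-- associated with a subset of the vertices (parallel edges allowed).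
record Hypergraph : Set where
  field
    nV       : ℕ
    nE       : ℕ
    nonempty : 1 ≤ nV
    inc      : Fin nE → Subset nV
open Hypergraph public

module _ (H : Hypergraph) where
  Vertex : Set
  Vertex = Fin (nV H)

  Edge : Set
  Edge = Fin (nE H)

  degree : Vertex → ℕ
  degree v = ∣ tabulate (λ e → lookup (inc H e) v) ∣

  Uniform : ℕ → Set
  Uniform r = (e : Edge) → ∣ inc H e ∣ ≡ r

  IsFlag : Vertex × Edge → Set
  IsFlag (v , e) = v ∈ₛ inc H e

  -- A walk v₀ e₁ v₁ … eₘ vₘ is represented as start vertex v₀ and the
  -- list of steps (eᵢ , vᵢ).
  Walk : Set
  Walk = Vertex × List (Edge × Vertex)

  IsWalkFrom : Vertex → List (Edge × Vertex) → Set
  IsWalkFrom v [] = ⊤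
  IsWalkFrom v ((e , w) ∷ s) = v ≢ w × v ∈ₛ inc H e × w ∈ₛ inc H e × IsWalkFrom w s

  lastFrom : Vertex → List (Edge × Vertex) → Vertex
  lastFrom v [] = v
  lastFrom v ((e , w) ∷ s) = lastFrom w s

  anchorFlagsFrom : Vertex → List (Edge × Vertex) → List (Vertex × Edge)
  anchorFlagsFrom v [] = []
  anchorFlagsFrom v ((e , w) ∷ s) = (v , e) ∷ (w , e) ∷ anchorFlagsFrom w s

  anchors : Walk → List Vertex
  anchors (v , s) = v ∷ map proj₂ s

  edgesOf : Walk → List Edge
  edgesOf (v , s) = map proj₁ s

  anchorFlags : Walk → List (Vertex × Edge)
  anchorFlags (v , s) = anchorFlagsFrom v s

  IsWalk : Walk → Set
  IsWalk (v , s) = IsWalkFrom v s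

  IsClosed : Walk → Set
  IsClosed (v , s) = 2 ≤ length s × v ≡ lastFrom v s

  IsStrict : Walk → Set
  IsStrict t = Unique (edgesOf t)

  IsClosedStrictTrail : Walk → Set
  IsClosedStrictTrail t = IsWalk t × IsClosed t × IsStrict t

  AnchorDisjoint : Walk → Walk → Set
  AnchorDisjoint t u = ∀ x → x ∈ₗ anchors t → ¬ (x ∈ₗ anchors u)

  Family : Set
  Family = List Walk

  IsEulerFamily : Family → Set
  IsEulerFamily F =
    All IsClosedStrictTrail F
    × (∀ (i j : Fin (length F)) → i ≢ j → AnchorDisjoint (L.lookup F i) (L.lookup F j))
    × (∀ (e : Edge) → Σ (Fin (length F)) λ i →
          e ∈ₗ edgesOf (L.lookup F i)
          × (∀ j → e ∈ₗ edgesOf (L.lookup F j) → j ≡ i))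

  IsAnchorFlagOf : Vertex × Edge → Family → Set
  IsAnchorFlagOf f F = Σ (Fin (length F)) λ i → f ∈ₗ anchorFlags (L.lookup F i)

  QuasiEulerian : Set
  QuasiEulerian = Σ Family IsEulerFamily

-- At every vertex pair up the incident edges into transitions, which is possible since degrees
-- are even; every flag then lies in exactly one transition. The transition graph, with the edges
-- of H as vertices and a link e — e′ for each transition (v , e , e′), is loopless and
-- 2k-regular. Orienting it along an Euler family gives every vertex in- and out-degree k, and
-- König's theorem colours the resulting k-regular bipartite graph with k colours, so that in
-- each colour every edge e of H is entered by one transition, at a vertex entry e, and left by
-- one, at a vertex exit e ≠ entry e. The graph on the vertices of H with a link
-- entry e — exit e for each edge e has even degrees, and an Euler family of it is an Euler family
-- of H whose anchor flags are exactly the flags of the transitions of that colour. Both uses of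
-- Euler families rest on the fact that every loopless even multigraph has one, proved by
-- splitting off pairs of arcs.

module Submission where

open import Defs
open import Data.Nat using (ℕ; _≤_; _*_)
open import Data.Nat.Divisibility using (_∣_)
open import Data.Fin using (Fin)
open import Data.Product using (Σ; _×_)
open import Relation.Binary.PropositionalEquality using (_≡_)

open import Data.Bool using (Bool; true; false; not; if_then_else_; T)
open import Data.Bool.Properties using (not-injective; T-≡)
open import Data.Empty using (⊥; ⊥-elim)
open import Data.Fin using (zero; suc; toℕ; fromℕ<; join; splitAt)
open import Data.Fin.Properties using (splitAt-join; toℕ-injective; toℕ-fromℕ<; injective⇒≤; toℕ<n) renaming (_≟_ to _≟ᶠ_; any? to anyᶠ?)
open import Data.Fin.Subset using (Subset; ∣_∣)
open import Data.List using (List; []; _∷_; _++_; [_]; map; concatMap; length; allFin; filter; filterᵇ; lookup; tabulate)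
open import Data.List.Properties using (map-++; map-∘; map-cong; map-id; length-map; length-tabulate; length-++-sucʳ; ++-assoc; concatMap-++; map-concatMap; concatMap-map; concatMap-cong)
open import Data.List.Membership.Propositional using (_∈_; _∉_; find; lose)
open import Data.List.Membership.Propositional.Properties using (∈-++⁺ˡ; ∈-++⁺ʳ; ∈-++⁻; ∈-map⁺; ∈-map⁻; ∈-∃++; ∈-concatMap⁺; ∈-concatMap⁻; ∈-allFin; ∈-lookup; ∈-filter⁺; ∈-filter⁻)
open import Data.List.Membership.Propositional.Properties.WithK using (unique∧set⇒bag)
import Data.List.Membership.DecPropositional as DecMembership
open import Data.List.Relation.Unary.Any using (Any; here; there; any?; index)
open import Data.List.Relation.Unary.Any.Properties using (lookup-index)
open import Data.List.Relation.Unary.All using (All; []; _∷_)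
import Data.List.Relation.Unary.All as All
open import Data.List.Relation.Unary.All.Properties using (¬Any⇒All¬; All¬⇒¬Any)
open import Data.List.Relation.Unary.AllPairs using (AllPairs; []; _∷_)
import Data.List.Relation.Unary.AllPairs as AllPairs
open import Data.List.Relation.Unary.Unique.Propositional using (Unique)
open import Data.List.Relation.Unary.Unique.Propositional.Properties using (Unique[x∷xs]⇒x∉xs; ++⁺; allFin⁺; filter⁺) renaming (map⁺ to Unique-map⁺; map⁻ to Unique-map⁻)
import Data.List.Relation.Binary.Permutation.Propositional as Perm
open import Data.List.Relation.Binary.Permutation.Propositional using (module PermutationReasoning; _↭_; prep; swap; ↭-refl; ↭-sym; ↭-trans; ↭-reflexive; ↭⇒↭ₛ)
open import Data.List.Relation.Binary.Permutation.Propositional.Properties using (shift; shifts; ∈-resp-↭; ++⁺ˡ; ++⁺ʳ; ++-comm; map⁺; drop-∷; ↭-length) renaming (++⁺ to ++-↭⁺)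
import Data.List.Relation.Binary.Permutation.Setoid.Properties as SetoidPermutation
open import Data.List.Relation.Binary.BagAndSetEquality using (∼bag⇒↭)
open import Data.Maybe using (Maybe; just; nothing)
import Data.Maybe as Maybe
import Data.Maybe.Properties as Maybe
open import Data.Nat using (zero; suc; _+_; _<_; _∸_; _<?_; z≤n; s≤s; s≤s⁻¹)
open import Data.Nat.Properties using (module ≤-Reasoning; ≤-refl; ≤-reflexive; ≤-trans; <⇒≤; ≤-<-trans; n≮n; m≤n+m; m∸n+n≡m; ≮⇒≥; <-cmp; +-assoc; +-comm; +-suc; +-identityʳ; *-comm; suc-injective; +-commutativeSemigroup)
open import Algebra.Properties.CommutativeSemigroup +-commutativeSemigroup using () renaming (interchange to +-interchange)
open import Data.Nat.Divisibility using (divides; ∣m+n∣m⇒∣n; ∣m∣n⇒∣m+n; ∣1⇒≡1)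
open import Data.Nat.ListAction using (sum)
open import Data.Product using (∃; ∃₂; _,_; proj₁; proj₂)
import Data.Product.Properties as Product
open import Data.Sum using (_⊎_; inj₁; inj₂; [_,_]′)
import Data.Sum.Properties as Sum
import Data.Vec as Vec
open import Data.Vec.Properties using ([]=⇒lookup; lookup⇒[]=; lookup∘tabulate)
open import Function using (id; _∘_)
open import Function.Bundles using (mk⇔; module Equivalence)
open import Relation.Binary.Definitions using (DecidableEquality; tri<; tri≈; tri>)
open import Relation.Binary.PropositionalEquality using (_≢_; refl; sym; cong; cong₂; subst; subst₂; setoid; module ≡-Reasoning) renaming (trans to ≡-trans)
open import Relation.Nullary using (¬_; Dec; yes; no; does)
open import Relation.Nullary.Decidable using (T?; ¬?; _×-dec_; _⊎-dec_)

private variable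
  A B C : Set
  x y z : A
  xs ys : List A

-- Uniqueness and multiplicities in lists

unique-∷ : x ∉ xs → Unique xs → Unique (x ∷ xs)
unique-∷ x∉xs u = ¬Any⇒All¬ _ x∉xs ∷ u

Unique-resp-↭ : xs ↭ ys → Unique xs → Unique ys
Unique-resp-↭ p = SetoidPermutation.Unique-resp-↭ (setoid _) (↭⇒↭ₛ p)

Unique-++⁻ˡ : ∀ xs → Unique (xs ++ ys) → Unique xs
Unique-++⁻ˡ [] _ = []
Unique-++⁻ˡ (x ∷ xs) (x∉ ∷ u) = All.tabulate (λ y∈xs → All.lookup x∉ (∈-++⁺ˡ y∈xs)) ∷ Unique-++⁻ˡ xs u

Unique-++⁻ʳ : ∀ xs → Unique (xs ++ ys) → Unique ys
Unique-++⁻ʳ [] u = u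
Unique-++⁻ʳ (x ∷ xs) (_ ∷ u) = Unique-++⁻ʳ xs u

Unique-++⇒disjoint : ∀ xs → Unique (xs ++ ys) → z ∈ xs → z ∉ ys
Unique-++⇒disjoint (w ∷ ws) u (here refl) z∈ys = Unique[x∷xs]⇒x∉xs u (∈-++⁺ʳ ws z∈ys)
Unique-++⇒disjoint (w ∷ ws) (_ ∷ u) (there z∈ws) z∈ys = Unique-++⇒disjoint ws u z∈ws z∈ys

unique∧set⇒↭ : Unique xs → Unique ys → (∀ {x} → x ∈ xs → x ∈ ys) → (∀ {x} → x ∈ ys → x ∈ xs) → xs ↭ ys
unique∧set⇒↭ u v to from = ∼bag⇒↭ (unique∧set⇒bag u v (mk⇔ to from))

∈-drop-mid : ∀ ws → z ∈ ws ++ x ∷ xs → z ≢ x → z ∈ ws ++ xs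
∈-drop-mid [] (here refl) z≢x = ⊥-elim (z≢x refl)
∈-drop-mid [] (there z∈) _ = z∈
∈-drop-mid (w ∷ ws) (here z≡w) _ = here z≡w
∈-drop-mid (w ∷ ws) (there z∈) z≢x = there (∈-drop-mid ws z∈ z≢x)

∈-add-mid : ∀ ws → z ∈ ws ++ xs → z ∈ ws ++ x ∷ xs
∈-add-mid [] z∈ = there z∈
∈-add-mid (w ∷ ws) (here z≡w) = here z≡w
∈-add-mid (w ∷ ws) (there z∈) = there (∈-add-mid ws z∈)

Unique⇒length≤ : Unique xs → (∀ {w} → w ∈ xs → w ∈ ys) → length xs ≤ length ys
Unique⇒length≤ {xs = []} _ _ = z≤n
Unique⇒length≤ {xs = x ∷ xs} u@(_ ∷ u′) xs⊆ys with ∈-∃++ (xs⊆ys (here refl))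
... | ws , vs , refl = subst (suc (length xs) ≤_) (sym (length-++-sucʳ ws x vs))
        (s≤s (Unique⇒length≤ u′ (λ w∈xs → ∈-drop-mid ws (xs⊆ys (there w∈xs)) (λ { refl → Unique[x∷xs]⇒x∉xs u w∈xs }))))

module _ {f : A → B} where

  Unique-map⇒injectiveOn : ∀ xs → Unique (map f xs) → x ∈ xs → y ∈ xs → f x ≡ f y → x ≡ y
  Unique-map⇒injectiveOn (w ∷ ws) u (here refl) (here refl) _ = refl
  Unique-map⇒injectiveOn (w ∷ ws) u (here refl) (there y∈) fx≡fy =
    ⊥-elim (Unique[x∷xs]⇒x∉xs u (subst (_∈ map f ws) (sym fx≡fy) (∈-map⁺ f y∈)))
  Unique-map⇒injectiveOn (w ∷ ws) u (there x∈) (here refl) fx≡fy =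
    ⊥-elim (Unique[x∷xs]⇒x∉xs u (subst (_∈ map f ws) fx≡fy (∈-map⁺ f x∈)))
  Unique-map⇒injectiveOn (w ∷ ws) (_ ∷ u) (there x∈) (there y∈) fx≡fy = Unique-map⇒injectiveOn ws u x∈ y∈ fx≡fy

  injectiveOn⇒Unique-map : Unique xs → (∀ {y y′} → y ∈ xs → y′ ∈ xs → f y ≡ f y′ → y ≡ y′) → Unique (map f xs)
  injectiveOn⇒Unique-map {xs = []} _ _ = []
  injectiveOn⇒Unique-map {xs = w ∷ ws} u inj =
    unique-∷ fw∉ (injectiveOn⇒Unique-map (AllPairs.tail u) (λ y∈ y′∈ → inj (there y∈) (there y′∈)))
    where
      fw∉ : f w ∉ map f ws
      fw∉ fw∈ with ∈-map⁻ f fw∈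
      ... | y , y∈ , fw≡fy = Unique[x∷xs]⇒x∉xs u (subst (_∈ ws) (sym (inj (here refl) (there y∈) fw≡fy)) y∈)

module _ (f : A → List B) where

  ∈-concatMap⁺′ : x ∈ xs → z ∈ f x → z ∈ concatMap f xs
  ∈-concatMap⁺′ x∈ z∈ = ∈-concatMap⁺ f (lose x∈ z∈)

  ∈-concatMap⁻′ : ∀ xs → z ∈ concatMap f xs → ∃ λ x → x ∈ xs × z ∈ f x
  ∈-concatMap⁻′ xs z∈ = find (∈-concatMap⁻ f {xs = xs} z∈)

  concatMap-mono : (∀ {x} → x ∈ xs → x ∈ ys) → z ∈ concatMap f xs → z ∈ concatMap f ys
  concatMap-mono {xs = xs} xs⊆ys z∈ with ∈-concatMap⁻′ xs z∈
  ... | x , x∈ , z∈fx = ∈-concatMap⁺′ (xs⊆ys x∈) z∈fx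

  Unique-concatMap⇒Unique : ∀ xs → Unique (concatMap f xs) → x ∈ xs → Unique (f x)
  Unique-concatMap⇒Unique (w ∷ ws) u (here refl) = Unique-++⁻ˡ (f w) u
  Unique-concatMap⇒Unique (w ∷ ws) u (there x∈) = Unique-concatMap⇒Unique ws (Unique-++⁻ʳ (f w) u) x∈

  Unique-concatMap⇒disjoint : ∀ xs → Unique (concatMap f xs) → x ∈ xs → y ∈ xs → x ≢ y → z ∈ f x → z ∉ f y
  Unique-concatMap⇒disjoint (w ∷ ws) u (here refl) (here refl) x≢y _ _ = x≢y refl
  Unique-concatMap⇒disjoint (w ∷ ws) u (here refl) (there y∈) _ z∈fx z∈fy =
    Unique-++⇒disjoint (f w) u z∈fx (∈-concatMap⁺′ y∈ z∈fy)
  Unique-concatMap⇒disjoint (w ∷ ws) u (there x∈) (here refl) _ z∈fx z∈fy =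
    Unique-++⇒disjoint (f w) u z∈fy (∈-concatMap⁺′ x∈ z∈fx)
  Unique-concatMap⇒disjoint (w ∷ ws) u (there x∈) (there y∈) x≢y z∈fx z∈fy =
    Unique-concatMap⇒disjoint ws (Unique-++⁻ʳ (f w) u) x∈ y∈ x≢y z∈fx z∈fy

  Unique-concatMap⇒lookup-injective : ∀ xs → Unique (concatMap f xs) → (i j : Fin (length xs)) →
    z ∈ f (lookup xs i) → z ∈ f (lookup xs j) → i ≡ j
  Unique-concatMap⇒lookup-injective (w ∷ ws) u zero zero _ _ = refl
  Unique-concatMap⇒lookup-injective (w ∷ ws) u zero (suc j) z∈ z∈′ =
    ⊥-elim (Unique-++⇒disjoint (f w) u z∈ (∈-concatMap⁺′ {xs = ws} (∈-lookup j) z∈′))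
  Unique-concatMap⇒lookup-injective (w ∷ ws) u (suc i) zero z∈ z∈′ =
    ⊥-elim (Unique-++⇒disjoint (f w) u z∈′ (∈-concatMap⁺′ {xs = ws} (∈-lookup i) z∈))
  Unique-concatMap⇒lookup-injective (w ∷ ws) u (suc i) (suc j) z∈ z∈′ =
    cong suc (Unique-concatMap⇒lookup-injective ws (Unique-++⁻ʳ (f w) u) i j z∈ z∈′)

  Unique-concatMap⁻ : ∀ xs → (∀ x → ∃ (_∈ f x)) → Unique (concatMap f xs) → Unique xs
  Unique-concatMap⁻ [] _ _ = []
  Unique-concatMap⁻ (x ∷ xs) nonempty u =
    unique-∷ (λ x∈ → Unique-++⇒disjoint (f x) u (proj₂ (nonempty x)) (∈-concatMap⁺′ x∈ (proj₂ (nonempty x))))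
             (Unique-concatMap⁻ xs nonempty (Unique-++⁻ʳ (f x) u))

  Unique-concatMap-filter⁺ : ∀ {P : A → Set} (P? : ∀ x → Dec (P x)) xs → Unique (concatMap f xs) → Unique (concatMap f (filter P? xs))
  Unique-concatMap-filter⁺ P? [] u = []
  Unique-concatMap-filter⁺ P? (x ∷ xs) u with does (P? x)
  ... | true = ++⁺ (Unique-++⁻ˡ (f x) u) (Unique-concatMap-filter⁺ P? xs (Unique-++⁻ʳ (f x) u))
                 (λ (z∈fx , z∈) → Unique-++⇒disjoint (f x) u z∈fx
                   (concatMap-mono {xs = filter P? xs} {ys = xs} (proj₁ ∘ ∈-filter⁻ P? {xs = xs}) z∈))
  ... | false = Unique-concatMap-filter⁺ P? xs (Unique-++⁻ʳ (f x) u)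

  Unique-concatMap⁺ : (key : B → A) → Unique xs → (∀ x → All (λ b → key b ≡ x) (f x)) → (∀ x → Unique (f x)) →
    Unique (concatMap f xs)
  Unique-concatMap⁺ {xs = []} key _ _ _ = []
  Unique-concatMap⁺ {xs = x ∷ xs} key u keyed v = ++⁺ (v x) (Unique-concatMap⁺ key (AllPairs.tail u) keyed v) disjoint
    where
      disjoint : ∀ {b} → ¬ (b ∈ f x × b ∈ concatMap f xs)
      disjoint (b∈fx , b∈) with ∈-concatMap⁻′ xs b∈
      ... | x′ , x′∈ , b∈fx′ =
        Unique[x∷xs]⇒x∉xs u (subst (_∈ xs) (≡-trans (sym (All.lookup (keyed x′) b∈fx′)) (All.lookup (keyed x) b∈fx)) x′∈)

length-filterᵇ-tabulate : ∀ {n} (f : Fin n → A) (g : A → Bool) (p : Subset n) → (∀ i → g (f i) ≡ Vec.lookup p i) →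
  length (filterᵇ g (tabulate f)) ≡ ∣ p ∣
length-filterᵇ-tabulate f g Vec.[] _ = refl
length-filterᵇ-tabulate f g (x Vec.∷ p) g≡p rewrite g≡p zero with x
... | true = cong suc (length-filterᵇ-tabulate (f ∘ suc) g p (g≡p ∘ suc))
... | false = length-filterᵇ-tabulate (f ∘ suc) g p (g≡p ∘ suc)

concatMap-concatMap : ∀ {B C : Set} (f : B → List C) (g : A → List B) xs →
  concatMap f (concatMap g xs) ≡ concatMap (concatMap f ∘ g) xs
concatMap-concatMap f g [] = refl
concatMap-concatMap f g (x ∷ xs) = ≡-trans (concatMap-++ f (g x) (concatMap g xs)) (cong (concatMap f (g x) ++_) (concatMap-concatMap f g xs))

map-inverse : ∀ {B : Set} {f : A → B} {g : B → A} → (∀ x → g (f x) ≡ x) → ∀ xs → map g (map f xs) ≡ xs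
map-inverse g∘f≡id xs = ≡-trans (sym (map-∘ xs)) (≡-trans (map-cong g∘f≡id xs) (map-id xs))

sum-indicators : ∀ (g : A → Bool) xs → sum (map (λ x → if g x then 1 else 0) xs) ≡ length (filterᵇ g xs)
sum-indicators g [] = refl
sum-indicators g (x ∷ xs) with g x
... | true = cong suc (sum-indicators g xs)
... | false = sum-indicators g xs

pairUp : List A → List (A × A)
pairUp (x ∷ y ∷ xs) = (x , y) ∷ pairUp xs
pairUp _ = []

AllPairs-lookup : ∀ {R : A → A → Set} → (∀ {x y} → R x y → R y x) → ∀ {xs} → AllPairs R xs →
  (i j : Fin (length xs)) → i ≢ j → R (lookup xs i) (lookup xs j)
AllPairs-lookup sym-R (r ∷ rs) zero zero i≢j = ⊥-elim (i≢j refl)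
AllPairs-lookup sym-R (r ∷ rs) zero (suc j) _ = All.lookup r (∈-lookup j)
AllPairs-lookup sym-R (r ∷ rs) (suc i) zero _ = sym-R (All.lookup r (∈-lookup i))
AllPairs-lookup sym-R (r ∷ rs) (suc i) (suc j) i≢j = AllPairs-lookup sym-R rs i j (i≢j ∘ cong suc)

++-≢[] : ∀ {A : Set} (xs : List A) {ys} → ys ≢ [] → xs ++ ys ≢ []
++-≢[] [] ys≢[] = ys≢[]
++-≢[] (x ∷ xs) _ ()

All-remove : ∀ {A : Set} {P : A → Set} xs {x ys} → All P (xs ++ x ∷ ys) → All P (xs ++ ys)
All-remove [] (_ ∷ ps) = ps
All-remove (_ ∷ xs) (p ∷ ps) = p ∷ All-remove xs ps

AllPairs-remove : ∀ {A : Set} {R : A → A → Set} xs {x ys} → AllPairs R (xs ++ x ∷ ys) → AllPairs R (xs ++ ys)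
AllPairs-remove [] (_ ∷ ps) = ps
AllPairs-remove (_ ∷ xs) (p ∷ ps) = All-remove xs p ∷ AllPairs-remove xs ps

2∣n+n : ∀ n → 2 ∣ n + n
2∣n+n n = divides n (sym (≡-trans (*-comm n 2) (cong (n +_) (+-identityʳ n))))

2∣n+[n+m]⇒2∣m : ∀ n m → 2 ∣ n + (n + m) → 2 ∣ m
2∣n+[n+m]⇒2∣m n m 2∣ = ∣m+n∣m⇒∣n (subst (2 ∣_) (sym (+-assoc n n m)) 2∣) (2∣n+n n)

2∣1+m⇒0<m : ∀ m → 2 ∣ 1 + m → 0 < m
2∣1+m⇒0<m zero 2∣1 with () ← ∣1⇒≡1 2∣1
2∣1+m⇒0<m (suc m) _ = s≤s z≤n

n+n≡m+m⇒n≡m : ∀ n m → n + n ≡ m + m → n ≡ m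
n+n≡m+m⇒n≡m zero zero _ = refl
n+n≡m+m⇒n≡m (suc n) (suc m) eq =
  cong suc (n+n≡m+m⇒n≡m n m (suc-injective (≡-trans (sym (+-suc n n)) (≡-trans (suc-injective eq) (+-suc m m)))))

module Occurrences {A : Set} (_≟_ : DecidableEquality A) where

  δ : A → A → ℕ
  δ x y = if does (x ≟ y) then 1 else 0

  occ : A → List A → ℕ
  occ x [] = 0
  occ x (y ∷ ys) = δ x y + occ x ys

  δ-refl : ∀ x → δ x x ≡ 1
  δ-refl x with x ≟ x
  ... | yes _ = refl
  ... | no x≢x = ⊥-elim (x≢x refl)

  δ-≢ : x ≢ y → δ x y ≡ 0
  δ-≢ {x} {y} x≢y with x ≟ y
  ... | yes x≡y = ⊥-elim (x≢y x≡y)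
  ... | no _ = refl

  occ-++ : ∀ x xs ys → occ x (xs ++ ys) ≡ occ x xs + occ x ys
  occ-++ x [] ys = refl
  occ-++ x (y ∷ xs) ys = ≡-trans (cong (δ x y +_) (occ-++ x xs ys)) (sym (+-assoc (δ x y) (occ x xs) (occ x ys)))

  occ-resp-↭ : ∀ x → xs ↭ ys → occ x xs ≡ occ x ys
  occ-resp-↭ x Perm.refl = refl
  occ-resp-↭ x (Perm.prep y p) = cong (δ x y +_) (occ-resp-↭ x p)
  occ-resp-↭ x (Perm.swap {xs = xs} {ys = ys} y w p) = begin
    δ x y + (δ x w + occ x xs) ≡⟨ cong (λ n → δ x y + (δ x w + n)) (occ-resp-↭ x p) ⟩
    δ x y + (δ x w + occ x ys) ≡⟨ sym (+-assoc (δ x y) (δ x w) _) ⟩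
    δ x y + δ x w + occ x ys   ≡⟨ cong (_+ occ x ys) (+-comm (δ x y) (δ x w)) ⟩
    δ x w + δ x y + occ x ys   ≡⟨ +-assoc (δ x w) (δ x y) _ ⟩
    δ x w + (δ x y + occ x ys) ∎
    where open ≡-Reasoning
  occ-resp-↭ x (Perm.trans p q) = ≡-trans (occ-resp-↭ x p) (occ-resp-↭ x q)

  occ>0⇒∈ : ∀ x xs → 0 < occ x xs → x ∈ xs
  occ>0⇒∈ x (y ∷ ys) occ>0 with x ≟ y
  ... | yes x≡y = here x≡y
  ... | no _ = there (occ>0⇒∈ x ys occ>0)

  ∉⇒occ≡0 : ∀ x xs → x ∉ xs → occ x xs ≡ 0
  ∉⇒occ≡0 x [] _ = refl
  ∉⇒occ≡0 x (y ∷ ys) x∉ with x ≟ y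
  ... | yes x≡y = ⊥-elim (x∉ (here x≡y))
  ... | no _ = ∉⇒occ≡0 x ys (x∉ ∘ there)

  occ-concatMap : ∀ {B : Set} x (f : B → List A) bs → occ x (concatMap f bs) ≡ sum (map (occ x ∘ f) bs)
  occ-concatMap x f [] = refl
  occ-concatMap x f (b ∷ bs) = ≡-trans (occ-++ x (f b) (concatMap f bs)) (cong (occ x (f b) +_) (occ-concatMap x f bs))

  occ-filterᵇ : ∀ {g : A → Bool} x xs → Unique xs → x ∈ xs → occ x (filterᵇ g xs) ≡ (if g x then 1 else 0)
  occ-filterᵇ {g} x (y ∷ ys) (x∉ ∷ u) (here refl) with g x
  ... | true = cong₂ _+_ (δ-refl x) (∉⇒occ≡0 x _ (All¬⇒¬Any x∉ ∘ proj₁ ∘ ∈-filter⁻ (T? ∘ g)))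
  ... | false = ∉⇒occ≡0 x _ (All¬⇒¬Any x∉ ∘ proj₁ ∘ ∈-filter⁻ (T? ∘ g))
  occ-filterᵇ {g} x (y ∷ ys) (y∉ ∷ u) (there x∈) with g y
  ... | true = cong₂ _+_ (δ-≢ (λ { refl → All¬⇒¬Any y∉ x∈ })) (occ-filterᵇ x ys u x∈)
  ... | false = occ-filterᵇ x ys u x∈

  occ-doubled : ∀ {B : Set} x (f : B → A) bs → 2 ∣ occ x (concatMap (λ b → f b ∷ f b ∷ []) bs)
  occ-doubled x f [] = divides 0 refl
  occ-doubled x f (b ∷ bs) = subst (2 ∣_) (+-assoc (δ x (f b)) (δ x (f b)) _)
    (∣m∣n⇒∣m+n (2∣n+n (δ x (f b))) (occ-doubled x f bs))

-- Euler families of even multigraphs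

module EulerFamilies {V E : Set} (_≟_ : DecidableEquality V) where

  open Occurrences _≟_
  open DecMembership _≟_ using (_∈?_)

  Arc : Set
  Arc = E × V × V

  Trail : Set
  Trail = V × List (E × V)

  endpoint : V → List (E × V) → V
  endpoint v [] = v
  endpoint v ((e , w) ∷ s) = endpoint w s

  arcsFrom : V → List (E × V) → List Arc
  arcsFrom v [] = []
  arcsFrom v ((e , w) ∷ s) = (e , v , w) ∷ arcsFrom w s

  arcs : Trail → List Arc
  arcs (v , s) = arcsFrom v s

  visits : Trail → List V
  visits (v , s) = v ∷ map proj₂ s

  Closed : Trail → Set
  Closed (v , s) = s ≢ [] × endpoint v s ≡ v

  VisitDisjoint : Trail → Trail → Set
  VisitDisjoint t u = ∀ {x} → x ∈ visits t → x ∉ visits u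

  arcsOf : List Trail → List Arc
  arcsOf = concatMap arcs

  ends : Arc → List V
  ends (_ , y , z) = y ∷ z ∷ []

  endsOf : List Arc → List V
  endsOf = concatMap ends

  labels : List Arc → List E
  labels = map proj₁

  reversed : Arc → Arc
  reversed (e , y , z) = (e , z , y)

  _∈±_ : Arc → List Arc → Set
  o ∈± gs = o ∈ gs ⊎ reversed o ∈ gs

  _≅_ : Arc → Arc → Set
  g ≅ o = g ≡ o ⊎ g ≡ reversed o

  NonLoop : Arc → Set
  NonLoop (_ , y , z) = y ≢ z

  -- A multigraph is a list of arcs with distinct labels; the orientation of an arc is immaterial,
  -- and a trail may traverse it either way.
  EvenGraph : List Arc → Set
  EvenGraph gs = Unique (labels gs) × All NonLoop gs × (∀ v → 2 ∣ occ v (endsOf gs))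

  record IsEulerFamilyOf (gs : List Arc) (F : List Trail) : Set where
    constructor eulerFamilyOf
    field
      closed : All Closed F
      disjoint : AllPairs VisitDisjoint F
      labels↭ : labels (arcsOf F) ↭ labels gs
      oriented : ∀ {o} → o ∈ arcsOf F → o ∈± gs

  ≅⇒∈± : ∀ {g o gs} → g ≅ o → g ∈ gs → o ∈± gs
  ≅⇒∈± (inj₁ refl) g∈ = inj₁ g∈
  ≅⇒∈± (inj₂ refl) g∈ = inj₂ g∈

  ≅-reversed : ∀ {g o} → g ≅ o → g ≅ reversed o
  ≅-reversed (inj₁ refl) = inj₂ refl
  ≅-reversed (inj₂ refl) = inj₁ refl

  ≅⇒label≡ : ∀ {g o} → g ≅ o → proj₁ g ≡ proj₁ o
  ≅⇒label≡ (inj₁ refl) = refl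
  ≅⇒label≡ (inj₂ refl) = refl

  ≅⇒ends↭ : ∀ {g o} → g ≅ o → ends g ↭ ends o
  ≅⇒ends↭ (inj₁ refl) = ↭-refl
  ≅⇒ends↭ (inj₂ refl) = swap _ _ ↭-refl

  endpoint-++ : ∀ v s s′ → endpoint v (s ++ s′) ≡ endpoint (endpoint v s) s′
  endpoint-++ v [] s′ = refl
  endpoint-++ v ((e , w) ∷ s) s′ = endpoint-++ w s s′

  arcsFrom-++ : ∀ v s s′ → arcsFrom v (s ++ s′) ≡ arcsFrom v s ++ arcsFrom (endpoint v s) s′
  arcsFrom-++ v [] s′ = refl
  arcsFrom-++ v ((e , w) ∷ s) s′ = cong ((e , v , w) ∷_) (arcsFrom-++ w s s′)

  rotateTo : (C : Trail) → Closed C → ∀ {z} → z ∈ visits C →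
    Σ Trail λ R → proj₁ R ≡ z × Closed R × arcs R ↭ arcs C × (∀ {x} → x ∈ visits R → x ∈ visits C)
  rotateTo C closed (here refl) = C , refl , closed , ↭-refl , id
  rotateTo (v , s) (_ , returns) {z} (there z∈) with ∈-map⁻ proj₂ z∈
  ... | (e , z) , e,z∈s , refl with ∈-∃++ e,z∈s
  ... | p , q , refl =
    (z , q ++ p ++ [ (e , z) ]) , refl ,
    (++-≢[] q (++-≢[] p (λ ())) , ≡-trans (endpoint-++ z q _) (endpoint-++ _ p _)) ,
    arcs-↭ , visits⊆
    where
      q-returns : endpoint z q ≡ v
      q-returns = ≡-trans (sym (endpoint-++ v p ((e , z) ∷ q))) returns
      arcs-↭ : arcsFrom z (q ++ p ++ [ (e , z) ]) ↭ arcsFrom v (p ++ (e , z) ∷ q)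
      arcs-↭ rewrite arcsFrom-++ z q (p ++ [ (e , z) ]) | q-returns | arcsFrom-++ v p ((e , z) ∷ [])
                   | arcsFrom-++ v p ((e , z) ∷ q) =
        ↭-trans (++-comm (arcsFrom z q) _) (↭-reflexive (++-assoc (arcsFrom v p) _ (arcsFrom z q)))
      visits⊆ : ∀ {x} → x ∈ visits (z , q ++ p ++ [ (e , z) ]) → x ∈ visits (v , p ++ (e , z) ∷ q)
      visits⊆ (here refl) = there z∈
      visits⊆ (there x∈) = there (∈-resp-↭ (map⁺ proj₂ (↭-trans (++-comm q (p ++ [ (e , z) ])) (↭-reflexive (++-assoc p [ (e , z) ] q)))) x∈)

  merge : (C D : Trail) → Closed C → Closed D → ∀ {z} → z ∈ visits C → z ∈ visits D →
    Σ Trail λ M → Closed M × arcs M ↭ arcs C ++ arcs D × (∀ {x} → x ∈ visits M → x ∈ visits C ⊎ x ∈ visits D)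
  merge C D closedC closedD z∈C z∈D with rotateTo C closedC z∈C | rotateTo D closedD z∈D
  ... | (z , s) , refl , (_ , returnsC) , arcsC , visitsC | (_ , s′) , refl , (s′≢[] , returnsD) , arcsD , visitsD =
    (z , s ++ s′) ,
    (++-≢[] s s′≢[] , ≡-trans (endpoint-++ z s s′) (≡-trans (cong (λ w → endpoint w s′) returnsC) returnsD)) ,
    ↭-trans (↭-reflexive (≡-trans (arcsFrom-++ z s s′) (cong (λ w → arcsFrom z s ++ arcsFrom w s′) returnsC))) (++-↭⁺ arcsC arcsD) ,
    visits⊆
    where
      visits⊆ : ∀ {x} → x ∈ visits (z , s ++ s′) → x ∈ visits C ⊎ x ∈ visits D
      visits⊆ (here refl) = inj₁ (visitsC (here refl))
      visits⊆ (there x∈) with ∈-++⁻ (map proj₂ s) (subst (_ ∈_) (map-++ proj₂ s s′) x∈)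
      ... | inj₁ x∈s = inj₁ (visitsC (there x∈s))
      ... | inj₂ x∈s′ = inj₂ (visitsD (there x∈s′))

  mergeInto : (C : Trail) (F : List Trail) → Closed C → All Closed F → AllPairs VisitDisjoint F →
    Σ (List Trail) λ F′ → All Closed F′ × AllPairs VisitDisjoint F′ × arcsOf F′ ↭ arcs C ++ arcsOf F
      × (∀ {t x} → t ∈ F′ → x ∈ visits t → x ∈ visits C ⊎ Any (λ u → x ∈ visits u) F)
  mergeInto C [] closedC _ _ = (C ∷ []) , (closedC ∷ []) , ([] ∷ []) , ↭-refl , (λ { (here refl) x∈ → inj₁ x∈ })
  mergeInto C (D ∷ F) closedC (closedD ∷ closedF) (D#F ∷ disjointF) with any? (_∈? visits D) (visits C)
  ... | yes meets with find meets
  ...   | z , z∈C , z∈D with merge C D closedC closedD z∈C z∈D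
  ...     | M , closedM , arcsM , visitsM with mergeInto M F closedM closedF disjointF
  ...       | F′ , closedF′ , disjointF′ , arcsF′ , visitsF′ = F′ , closedF′ , disjointF′ , arcs-↭ , visits⊆
    where
      arcs-↭ : arcsOf F′ ↭ arcs C ++ (arcs D ++ arcsOf F)
      arcs-↭ = ↭-trans arcsF′ (↭-trans (++⁺ʳ (arcsOf F) arcsM) (↭-reflexive (++-assoc (arcs C) (arcs D) (arcsOf F))))
      visits⊆ : ∀ {t x} → t ∈ F′ → x ∈ visits t → x ∈ visits C ⊎ Any (λ u → x ∈ visits u) (D ∷ F)
      visits⊆ t∈ x∈ with visitsF′ t∈ x∈
      ... | inj₂ x∈F = inj₂ (there x∈F)
      ... | inj₁ x∈M with visitsM x∈M
      ...   | inj₁ x∈C = inj₁ x∈C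
      ...   | inj₂ x∈D = inj₂ (here x∈D)
  mergeInto C (D ∷ F) closedC (closedD ∷ closedF) (D#F ∷ disjointF) | no misses with mergeInto C F closedC closedF disjointF
  ... | F′ , closedF′ , disjointF′ , arcsF′ , visitsF′ =
    (D ∷ F′) , (closedD ∷ closedF′) , (All.tabulate D#F′ ∷ disjointF′) ,
    ↭-trans (++⁺ˡ (arcs D) arcsF′) (shifts (arcs D) (arcs C)) , visits⊆
    where
      D#F′ : ∀ {t} → t ∈ F′ → VisitDisjoint D t
      D#F′ t∈ x∈D x∈t with visitsF′ t∈ x∈t
      ... | inj₁ x∈C = misses (lose x∈C x∈D)
      ... | inj₂ x∈F with find x∈F
      ...   | u , u∈F , x∈u = All.lookup D#F u∈F x∈D x∈u
      visits⊆ : ∀ {t x} → t ∈ D ∷ F′ → x ∈ visits t → x ∈ visits C ⊎ Any (λ u → x ∈ visits u) (D ∷ F)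
      visits⊆ (here refl) x∈ = inj₂ (here x∈)
      visits⊆ (there t∈) x∈ with visitsF′ t∈ x∈
      ... | inj₁ x∈C = inj₁ x∈C
      ... | inj₂ x∈F = inj₂ (there x∈F)

  splitAtArc : ∀ v s {e y z} → (e , y , z) ∈ arcsFrom v s → ∃₂ λ p q → s ≡ p ++ (e , z) ∷ q × endpoint v p ≡ y
  splitAtArc v ((e , w) ∷ s) (here refl) = [] , s , refl , refl
  splitAtArc v ((e , w) ∷ s) (there a∈) with splitAtArc w s a∈
  ... | p , q , refl , p-ends = ((e , w) ∷ p) , q , refl , p-ends

  subdivide : (t : Trail) → Closed t → ∀ {e y z} → (e , y , z) ∈ arcs t → ∀ e₁ e₂ a →
    Σ Trail λ t′ → Σ (List Arc) λ rest → Closed t′ × arcs t ↭ (e , y , z) ∷ rest × arcs t′ ↭ (e₁ , y , a) ∷ (e₂ , a , z) ∷ rest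
  subdivide (v , s) (_ , returns) {e} {y} {z} a∈ e₁ e₂ a with splitAtArc v s a∈
  ... | p , q , refl , refl =
    (v , p ++ (e₁ , a) ∷ (e₂ , z) ∷ q) , (arcsFrom v p ++ arcsFrom z q) ,
    (++-≢[] p (λ ()) , ≡-trans (endpoint-++ v p _) (≡-trans (sym (endpoint-++ v p ((e , z) ∷ q))) returns)) ,
    ↭-trans (↭-reflexive (arcsFrom-++ v p ((e , z) ∷ q))) (shift _ (arcsFrom v p) (arcsFrom z q)) ,
    ↭-trans (↭-reflexive (arcsFrom-++ v p ((e₁ , a) ∷ (e₂ , z) ∷ q))) (shifts (arcsFrom v p) ((e₁ , endpoint v p , a) ∷ (e₂ , a , z) ∷ []))

  arcsOf-remove : ∀ F t F′ → arcsOf (F ++ t ∷ F′) ↭ arcs t ++ arcsOf (F ++ F′)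
  arcsOf-remove F t F′ = ↭-trans (↭-reflexive (concatMap-++ arcs F (t ∷ F′)))
    (↭-trans (shifts (arcsOf F) (arcs t)) (↭-reflexive (cong (arcs t ++_) (sym (concatMap-++ arcs F F′)))))

  -- As the arc a → b is not a loop, a has odd degree in rest.
  second-arc : ∀ e a b rest → a ≢ b → 2 ∣ occ a (endsOf ((e , a , b) ∷ rest)) → a ∈ endsOf rest
  second-arc e a b rest a≢b 2∣deg = occ>0⇒∈ a (endsOf rest)
    (2∣1+m⇒0<m _ (subst₂ (λ m n → 2 ∣ m + (n + occ a (endsOf rest))) (δ-refl a) (δ-≢ a≢b) 2∣deg))

  -- The induction step: the arc e : a → b and a second arc e′ between a and x are replaced by the
  -- single arc e : b → x (or deleted, if x ≡ b); a trail through e : b → x is then rerouted through a.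
  module SplitOff (n : ℕ) (IH : ∀ gs → length gs ≤ n → EvenGraph gs → Σ (List Trail) (IsEulerFamilyOf gs))
                  (e : E) (a b : V) (e′ : E) (x : V) (pre post : List Arc) (g : Arc) (g≅ : g ≅ (e′ , a , x))
                  (length≤ : length (pre ++ g ∷ post) ≤ n) (even : EvenGraph ((e , a , b) ∷ pre ++ g ∷ post)) where

    gs rest : List Arc
    gs = (e , a , b) ∷ pre ++ g ∷ post
    rest = pre ++ post

    rest⊆gs : ∀ {o} → o ∈ rest → o ∈ gs
    rest⊆gs o∈ = there (∈-add-mid pre o∈)

    ∈±-rest⇒∈±-gs : ∀ {o} → o ∈± rest → o ∈± gs
    ∈±-rest⇒∈±-gs (inj₁ o∈) = inj₁ (rest⊆gs o∈)
    ∈±-rest⇒∈±-gs (inj₂ o∈) = inj₂ (rest⊆gs o∈)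

    g∈gs : g ∈ gs
    g∈gs = there (∈-++⁺ʳ pre (here refl))

    endsOf-gs : endsOf gs ↭ a ∷ a ∷ b ∷ x ∷ endsOf rest
    endsOf-gs = ↭-trans (prep a (prep b endsOf-pre++g∷post)) (prep a (swap b a ↭-refl))
      where
        endsOf-pre++g∷post : endsOf (pre ++ g ∷ post) ↭ a ∷ x ∷ endsOf rest
        endsOf-pre++g∷post = ↭-trans (↭-reflexive (concatMap-++ ends pre (g ∷ post)))
          (↭-trans (shifts (endsOf pre) (ends g))
            (↭-trans (↭-reflexive (cong (ends g ++_) (sym (concatMap-++ ends pre post)))) (++⁺ʳ (endsOf rest) (≅⇒ends↭ g≅))))

    labels-gs : labels gs ↭ e ∷ e′ ∷ labels rest
    labels-gs = prep e (↭-trans (↭-reflexive (map-++ proj₁ pre (g ∷ post)))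
      (↭-trans (shift (proj₁ g) (labels pre) (labels post)) (↭-reflexive (cong₂ _∷_ (≅⇒label≡ g≅) (sym (map-++ proj₁ pre post))))))

    unique-e∷e′∷rest : Unique (e ∷ e′ ∷ labels rest)
    unique-e∷e′∷rest = Unique-resp-↭ labels-gs (proj₁ even)

    e∉rest : e ∉ labels rest
    e∉rest = Unique[x∷xs]⇒x∉xs unique-e∷e′∷rest ∘ there

    unique-rest : Unique (labels rest)
    unique-rest = AllPairs.tail (AllPairs.tail unique-e∷e′∷rest)

    nonLoop-rest : All NonLoop rest
    nonLoop-rest = All.tabulate (All.lookup (proj₁ (proj₂ even)) ∘ rest⊆gs)

    length-rest : suc (length rest) ≤ n
    length-rest = subst (_≤ n) (length-++-sucʳ pre g post) length≤

    even-b∷x∷rest : ∀ v → 2 ∣ occ v (b ∷ x ∷ endsOf rest)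
    even-b∷x∷rest v = 2∣n+[n+m]⇒2∣m (δ v a) _ (subst (2 ∣_) (occ-resp-↭ v endsOf-gs) (proj₂ (proj₂ even) v))

    family-closing : x ≡ b → Σ (List Trail) (IsEulerFamilyOf gs)
    family-closing refl
      with IH rest (<⇒≤ length-rest) (unique-rest , nonLoop-rest , λ v → 2∣n+[n+m]⇒2∣m (δ v x) _ (even-b∷x∷rest v))
    ... | F , eulerFamilyOf closedF disjointF labelsF orientedF
      with mergeInto (x , (e , a) ∷ (e′ , x) ∷ []) F ((λ ()) , refl) closedF disjointF
    ... | F′ , closedF′ , disjointF′ , arcsF′ , _ = F′ , eulerFamilyOf closedF′ disjointF′ labels-↭ oriented
      where
        labels-↭ : labels (arcsOf F′) ↭ labels gs
        labels-↭ = ↭-trans (map⁺ proj₁ arcsF′) (↭-trans (prep e (prep e′ labelsF)) (↭-sym labels-gs))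
        oriented : ∀ {o} → o ∈ arcsOf F′ → o ∈± gs
        oriented o∈ with ∈-resp-↭ arcsF′ o∈
        ... | here refl = inj₂ (here refl)
        ... | there (here refl) = ≅⇒∈± g≅ g∈gs
        ... | there (there o∈F) = ∈±-rest⇒∈±-gs (orientedF o∈F)

    reroute : (F : List Trail) → IsEulerFamilyOf ((e , b , x) ∷ rest) F → ∀ {y z} → (e , y , z) ∈ arcsOf F →
      ∀ e₁ e₂ → (e₁ , y , a) ∈± gs → (e₂ , a , z) ∈± gs → e₁ ∷ e₂ ∷ labels rest ↭ e ∷ e′ ∷ labels rest →
      Σ (List Trail) (IsEulerFamilyOf gs)
    reroute F (eulerFamilyOf closedF disjointF labelsF orientedF) {y} {z} o∈ e₁ e₂ oriented₁ oriented₂ labels₁₂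
      with ∈-concatMap⁻′ arcs F o∈
    ... | t , t∈F , o∈t with ∈-∃++ t∈F
    ... | F₁ , F₂ , refl with subdivide t (All.lookup closedF t∈F) o∈t e₁ e₂ a
    ... | t′ , arcs-t , closed-t′ , arcs-t↭ , arcs-t′↭
      with mergeInto t′ (F₁ ++ F₂) closed-t′ (All-remove F₁ closedF) (AllPairs-remove F₁ disjointF)
    ... | F′ , closedF′ , disjointF′ , arcsF′ , _ = F′ , eulerFamilyOf closedF′ disjointF′ labels-↭ oriented
      where
        others : List Arc
        others = arcs-t ++ arcsOf (F₁ ++ F₂)
        arcsF↭ : arcsOf (F₁ ++ t ∷ F₂) ↭ (e , y , z) ∷ others
        arcsF↭ = ↭-trans (arcsOf-remove F₁ t F₂) (++⁺ʳ (arcsOf (F₁ ++ F₂)) arcs-t↭)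
        labels-others : labels others ↭ labels rest
        labels-others = drop-∷ (↭-trans (↭-sym (map⁺ proj₁ arcsF↭)) labelsF)
        arcsF′↭ : arcsOf F′ ↭ (e₁ , y , a) ∷ (e₂ , a , z) ∷ others
        arcsF′↭ = ↭-trans arcsF′ (++⁺ʳ (arcsOf (F₁ ++ F₂)) arcs-t′↭)
        labels-↭ : labels (arcsOf F′) ↭ labels gs
        labels-↭ = ↭-trans (map⁺ proj₁ arcsF′↭) (↭-trans (prep e₁ (prep e₂ labels-others)) (↭-trans labels₁₂ (↭-sym labels-gs)))
        e∉others : ∀ {o} → o ∈ others → proj₁ o ≢ e
        e∉others o∈ refl = e∉rest (∈-resp-↭ labels-others (∈-map⁺ proj₁ o∈))
        other-oriented : ∀ {o} → o ∈ others → o ∈± ((e , b , x) ∷ rest) → o ∈± gs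
        other-oriented o∈ (inj₁ (here refl)) = ⊥-elim (e∉others o∈ refl)
        other-oriented o∈ (inj₁ (there o∈rest)) = inj₁ (rest⊆gs o∈rest)
        other-oriented o∈ (inj₂ (here refl)) = ⊥-elim (e∉others o∈ refl)
        other-oriented o∈ (inj₂ (there o∈rest)) = inj₂ (rest⊆gs o∈rest)
        oriented : ∀ {o} → o ∈ arcsOf F′ → o ∈± gs
        oriented o∈ with ∈-resp-↭ arcsF′↭ o∈
        ... | here refl = oriented₁
        ... | there (here refl) = oriented₂
        ... | there (there o∈others) = other-oriented o∈others (orientedF (∈-resp-↭ (↭-sym arcsF↭) (there o∈others)))

    labelled-e : ∀ {o} → o ∈± ((e , b , x) ∷ rest) → proj₁ o ≡ e → o ≅ (e , b , x)
    labelled-e (inj₁ (here refl)) _ = inj₁ refl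
    labelled-e (inj₁ (there o∈)) refl = ⊥-elim (e∉rest (∈-map⁺ proj₁ o∈))
    labelled-e (inj₂ (here refl)) _ = inj₂ refl
    labelled-e (inj₂ (there o∈)) refl = ⊥-elim (e∉rest (∈-map⁺ proj₁ o∈))

    family-open : x ≢ b → Σ (List Trail) (IsEulerFamilyOf gs)
    family-open x≢b
      with IH ((e , b , x) ∷ rest) length-rest (unique-∷ e∉rest unique-rest , (x≢b ∘ sym) ∷ nonLoop-rest , even-b∷x∷rest)
    ... | F , family@(eulerFamilyOf _ _ labelsF orientedF) with ∈-map⁻ proj₁ (∈-resp-↭ (↭-sym labelsF) (here refl))
    ... | o , o∈ , refl with labelled-e (orientedF o∈) refl
    ... | inj₁ refl = reroute F family o∈ e e′ (inj₂ (here refl)) (≅⇒∈± g≅ g∈gs) ↭-refl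
    ... | inj₂ refl = reroute F family o∈ e′ e (≅⇒∈± (≅-reversed g≅) g∈gs) (inj₁ (here refl)) (swap e′ e ↭-refl)

    family : Σ (List Trail) (IsEulerFamilyOf gs)
    family with x ≟ b
    ... | yes x≡b = family-closing x≡b
    ... | no x≢b = family-open x≢b

  eulerFamily′ : ∀ n gs → length gs ≤ n → EvenGraph gs → Σ (List Trail) (IsEulerFamilyOf gs)
  eulerFamily′ _ [] _ _ = [] , eulerFamilyOf [] [] ↭-refl (λ ())
  eulerFamily′ (suc n) ((e , a , b) ∷ rest) (s≤s length≤) even@(_ , a≢b ∷ _ , evenDegrees)
    with ∈-concatMap⁻′ ends rest (second-arc e a b rest a≢b (evenDegrees a))
  ... | (e′ , _ , d) , g∈ , here refl with ∈-∃++ g∈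
  ...   | pre , post , refl = SplitOff.family n (eulerFamily′ n) e a b e′ d pre post (e′ , a , d) (inj₁ refl) length≤ even
  eulerFamily′ (suc n) ((e , a , b) ∷ rest) (s≤s length≤) even@(_ , a≢b ∷ _ , evenDegrees)
      | (e′ , c , _) , g∈ , there (here refl) with ∈-∃++ g∈
  ...   | pre , post , refl = SplitOff.family n (eulerFamily′ n) e a b e′ c pre post (e′ , c , a) (inj₂ refl) length≤ even

  eulerFamily : ∀ gs → EvenGraph gs → Σ (List Trail) (IsEulerFamilyOf gs)
  eulerFamily gs = eulerFamily′ (length gs) gs ≤-refl

  source target : Arc → V
  source (_ , y , _) = y
  target (_ , _ , z) = z

  labels-arcsFrom : ∀ v s → labels (arcsFrom v s) ≡ map proj₁ s
  labels-arcsFrom v [] = refl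
  labels-arcsFrom v ((e , w) ∷ s) = cong (e ∷_) (labels-arcsFrom w s)

  sources-arcsFrom : ∀ v s → map source (arcsFrom v s) ++ [ endpoint v s ] ≡ v ∷ map target (arcsFrom v s)
  sources-arcsFrom v [] = refl
  sources-arcsFrom v ((e , w) ∷ s) = cong (v ∷_) (sources-arcsFrom w s)

  closed⇒sources↭targets : ∀ t → Closed t → map source (arcs t) ↭ map target (arcs t)
  closed⇒sources↭targets (v , s) (_ , returns) = drop-∷ (↭-trans (↭-sym (++-comm (map source (arcsFrom v s)) [ v ]))
    (↭-reflexive (subst (λ w → map source (arcsFrom v s) ++ [ w ] ≡ v ∷ map target (arcsFrom v s)) returns (sources-arcsFrom v s))))

  sources↭targets : ∀ {F} → All Closed F → map source (arcsOf F) ↭ map target (arcsOf F)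
  sources↭targets [] = ↭-refl
  sources↭targets {t ∷ F} (closed ∷ closedF) =
    ↭-trans (↭-reflexive (map-++ source (arcs t) (arcsOf F)))
      (↭-trans (++-↭⁺ (closed⇒sources↭targets t closed) (sources↭targets closedF)) (↭-reflexive (sym (map-++ target (arcs t) (arcsOf F)))))

  concatMap-orientation : ∀ {B : Set} (f : Arc → List B) → (∀ o → f (reversed o) ↭ f o) → ∀ X gs →
    Unique (labels gs) → labels X ↭ labels gs → (∀ {o} → o ∈ X → o ∈± gs) → concatMap f X ↭ concatMap f gs
  concatMap-orientation f _ [] [] _ _ _ = ↭-refl
  concatMap-orientation f _ [] (g ∷ gs) _ labels↭ _ with () ← ↭-length labels↭
  concatMap-orientation f f-reversed ((e , y , z) ∷ X) gs u labels↭ oriented with same-label (oriented (here refl))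
    where
      same-label : (e , y , z) ∈± gs → Σ Arc λ g → g ∈ gs × f g ↭ f (e , y , z) × proj₁ g ≡ e
      same-label (inj₁ o∈) = (e , y , z) , o∈ , ↭-refl , refl
      same-label (inj₂ o∈) = (e , z , y) , o∈ , f-reversed (e , y , z) , refl
  ... | g , g∈ , fg↭ , g-label with ∈-∃++ g∈
  ... | pre , post , refl = ↭-trans (++-↭⁺ (↭-sym fg↭) IH) (↭-sym concatMap-gs)
    where
      labels-gs : labels (pre ++ g ∷ post) ↭ e ∷ labels (pre ++ post)
      labels-gs = ↭-trans (↭-reflexive (map-++ proj₁ pre (g ∷ post)))
        (↭-trans (shift (proj₁ g) (labels pre) (labels post)) (↭-reflexive (cong₂ _∷_ g-label (sym (map-++ proj₁ pre post)))))
      e∉X : e ∉ labels X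
      e∉X = Unique[x∷xs]⇒x∉xs (Unique-resp-↭ (↭-sym labels↭) u)
      oriented′ : ∀ {o} → o ∈ X → o ∈± (pre ++ post)
      oriented′ o∈ with oriented (there o∈)
      ... | inj₁ o∈gs = inj₁ (∈-drop-mid pre o∈gs (λ { refl → e∉X (subst (_∈ labels X) g-label (∈-map⁺ proj₁ o∈)) }))
      ... | inj₂ o∈gs = inj₂ (∈-drop-mid pre o∈gs (λ { refl → e∉X (subst (_∈ labels X) g-label (∈-map⁺ proj₁ o∈)) }))
      IH : concatMap f X ↭ concatMap f (pre ++ post)
      IH = concatMap-orientation f f-reversed X (pre ++ post) (AllPairs.tail (Unique-resp-↭ labels-gs u))
             (drop-∷ (↭-trans labels↭ labels-gs)) oriented′
      concatMap-gs : concatMap f (pre ++ g ∷ post) ↭ f g ++ concatMap f (pre ++ post)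
      concatMap-gs = ↭-trans (↭-reflexive (concatMap-++ f pre (g ∷ post)))
        (↭-trans (shifts (concatMap f pre) (f g)) (↭-reflexive (cong (f g ++_) (sym (concatMap-++ f pre post)))))

  concatMap-arcsOf : ∀ {B : Set} (f : Arc → List B) → (∀ o → f (reversed o) ↭ f o) → ∀ {gs F} →
    Unique (labels gs) → IsEulerFamilyOf gs F → concatMap f (arcsOf F) ↭ concatMap f gs
  concatMap-arcsOf f f-reversed {gs} {F} u (eulerFamilyOf _ _ labelsF orientedF) =
    concatMap-orientation f f-reversed (arcsOf F) gs u labelsF orientedF

  occ-endsOf : ∀ v os → occ v (endsOf os) ≡ occ v (map source os) + occ v (map target os)
  occ-endsOf v [] = refl
  occ-endsOf v (o ∷ os) rewrite occ-endsOf v os =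
    ≡-trans (sym (+-assoc (δ v (source o)) (δ v (target o)) _)) (+-interchange (δ v (source o)) (δ v (target o)) _ _)

  occ-sources-half : ∀ {gs F} → Unique (labels gs) → IsEulerFamilyOf gs F →
    ∀ v → occ v (map source (arcsOf F)) + occ v (map source (arcsOf F)) ≡ occ v (endsOf gs)
  occ-sources-half {gs} {F} u family v = begin
    occ v (map source (arcsOf F)) + occ v (map source (arcsOf F))
      ≡⟨ cong (occ v (map source (arcsOf F)) +_) (occ-resp-↭ v (sources↭targets (IsEulerFamilyOf.closed family))) ⟩
    occ v (map source (arcsOf F)) + occ v (map target (arcsOf F))  ≡⟨ sym (occ-endsOf v (arcsOf F)) ⟩
    occ v (endsOf (arcsOf F))                                      ≡⟨ occ-resp-↭ v (concatMap-arcsOf ends (λ _ → swap _ _ ↭-refl) u family) ⟩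
    occ v (endsOf gs)                                              ∎
    where open ≡-Reasoning

-- Edge colourings of bipartite multigraphs

module ColourCounting {A : Set} (_≟ᴬ_ : DecidableEquality A) (k : ℕ) where

  open Occurrences _≟ᴬ_
  open DecMembership (Product.≡-dec _≟ᴬ_ (_≟ᶠ_ {k})) using (_∈?_)

  at? : ∀ u (p : A × Fin k) → Dec (u ≡ proj₁ p)
  at? u p = u ≟ᴬ proj₁ p

  coloursAt : A → List (A × Fin k) → List (A × Fin k)
  coloursAt u = filter (at? u)

  length-coloursAt : ∀ u K → length (coloursAt u K) ≡ occ u (map proj₁ K)
  length-coloursAt u [] = refl
  length-coloursAt u ((v , c) ∷ K) with u ≟ᴬ v
  ... | yes _ = cong suc (length-coloursAt u K)
  ... | no _ = length-coloursAt u K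

  allColours : A → List (A × Fin k)
  allColours u = map (u ,_) (allFin k)

  length-allColours : ∀ u → length (allColours u) ≡ k
  length-allColours u = ≡-trans (length-map (u ,_) (allFin k)) (length-tabulate id)

  ∈-allColours : ∀ u {p} → proj₁ p ≡ u → p ∈ allColours u
  ∈-allColours u {v , c} refl = ∈-map⁺ (u ,_) (∈-allFin c)

  allColoursPresent : ∀ K u → Unique K → occ u (map proj₁ K) ≡ k → ∀ c → (u , c) ∈ K
  allColoursPresent K u unique occ≡k c with (u , c) ∈? K
  ... | yes uc∈K = uc∈K
  ... | no uc∉K = ⊥-elim (n≮n k (begin-strict
    k                          ≡⟨ sym occ≡k ⟩
    occ u (map proj₁ K)        ≡⟨ sym (length-coloursAt u K) ⟩
    length (coloursAt u K)     <⟨ ≤-refl ⟩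
    length ((u , c) ∷ coloursAt u K)
      ≤⟨ Unique⇒length≤ (unique-∷ (uc∉K ∘ proj₁ ∘ ∈-filter⁻ (at? u) {xs = K}) (filter⁺ (at? u) unique)) ⊆allColours ⟩
    length (allColours u)      ≡⟨ length-allColours u ⟩
    k                          ∎))
    where
      open ≤-Reasoning
      ⊆allColours : ∀ {p} → p ∈ (u , c) ∷ coloursAt u K → p ∈ allColours u
      ⊆allColours (here refl) = ∈-allColours u refl
      ⊆allColours (there p∈) = ∈-allColours u (sym (proj₂ (∈-filter⁻ (at? u) {xs = K} p∈)))

  missingColour : ∀ K u → occ u (map proj₁ K) < k → Σ (Fin k) λ c → (u , c) ∉ K
  missingColour K u occ<k with anyᶠ? (λ c → ¬? ((u , c) ∈? K))
  ... | yes missing = missing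
  ... | no noneMissing = ⊥-elim (n≮n k (≤-<-trans (begin
    k                          ≡⟨ sym (length-allColours u) ⟩
    length (allColours u)      ≤⟨ Unique⇒length≤ (Unique-map⁺ (cong proj₂) (allFin⁺ k)) allColours⊆ ⟩
    length (coloursAt u K)     ≡⟨ length-coloursAt u K ⟩
    occ u (map proj₁ K)        ∎) occ<k))
    where
      open ≤-Reasoning
      present : ∀ c → (u , c) ∈ K
      present c with (u , c) ∈? K
      ... | yes uc∈K = uc∈K
      ... | no uc∉K = ⊥-elim (noneMissing (c , uc∉K))
      allColours⊆ : ∀ {p} → p ∈ allColours u → p ∈ coloursAt u K
      allColours⊆ p∈ with ∈-map⁻ (u ,_) p∈
      ... | c , _ , refl = ∈-filter⁺ (at? u) (present c) refl

module BipartiteEdgeColouring {Λ : Set} (m k : ℕ) where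

  Link : Set
  Link = Λ × Fin m × Fin m

  ColouredLink : Set
  ColouredLink = Λ × Fin m × Fin m × Fin k

  left right : ColouredLink → Fin m
  left (_ , l , _ , _) = l
  right (_ , _ , r , _) = r

  colour : ColouredLink → Fin k
  colour (_ , _ , _ , c) = c

  uncoloured : ColouredLink → Link
  uncoloured (λ′ , l , r , _) = λ′ , l , r

  leftKey rightKey : ColouredLink → Fin m × Fin k
  leftKey y = left y , colour y
  rightKey y = right y , colour y

  Proper : List ColouredLink → Set
  Proper L = Unique (map leftKey L) × Unique (map rightKey L)

  partner : (near far : ColouredLink → Fin m) → Fin k → Fin m → List ColouredLink → Maybe (Fin m)
  partner near far γ x [] = nothing
  partner near far γ x (y ∷ ys) with near y ≟ᶠ x | colour y ≟ᶠ γ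
  ... | yes _ | yes _ = just (far y)
  ... | yes _ | no _ = partner near far γ x ys
  ... | no _ | _ = partner near far γ x ys

  module _ (near far : ColouredLink → Fin m) where

    partner-sound : ∀ γ x L r → partner near far γ x L ≡ just r →
      Σ ColouredLink λ y → y ∈ L × near y ≡ x × colour y ≡ γ × far y ≡ r
    partner-sound γ x (y ∷ ys) r found with near y ≟ᶠ x | colour y ≟ᶠ γ
    ... | yes near≡x | yes colour≡γ = y , here refl , near≡x , colour≡γ , Maybe.just-injective found
    ... | yes _ | no _ with partner-sound γ x ys r found
    ...   | y′ , y′∈ , props = y′ , there y′∈ , props
    partner-sound γ x (y ∷ ys) r found | no _ | _ with partner-sound γ x ys r found
    ...   | y′ , y′∈ , props = y′ , there y′∈ , props

    partner-complete : ∀ γ L y → Unique (map (λ y → near y , colour y) L) → y ∈ L → colour y ≡ γ →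
      partner near far γ (near y) L ≡ just (far y)
    partner-complete γ (y₀ ∷ ys) y u y∈ colour≡γ with near y₀ ≟ᶠ near y | colour y₀ ≟ᶠ γ
    partner-complete γ (y₀ ∷ ys) y u (here refl) colour≡γ | yes _ | yes _ = refl
    partner-complete γ (y₀ ∷ ys) y u (there y∈) colour≡γ | yes near≡ | yes colour₀≡γ =
      ⊥-elim (Unique[x∷xs]⇒x∉xs u (subst (_∈ map (λ y → near y , colour y) ys)
        (cong₂ _,_ (sym near≡) (≡-trans colour≡γ (sym colour₀≡γ))) (∈-map⁺ (λ y → near y , colour y) y∈)))
    partner-complete γ (y₀ ∷ ys) y u (here refl) colour≡γ | yes _ | no colour≢γ = ⊥-elim (colour≢γ colour≡γ)
    partner-complete γ (y₀ ∷ ys) y u (there y∈) colour≡γ | yes _ | no _ = partner-complete γ ys y (AllPairs.tail u) y∈ colour≡γ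
    partner-complete γ (y₀ ∷ ys) y u (here refl) colour≡γ | no near≢ | _ = ⊥-elim (near≢ refl)
    partner-complete γ (y₀ ∷ ys) y u (there y∈) colour≡γ | no _ | _ = partner-complete γ ys y (AllPairs.tail u) y∈ colour≡γ

  -- The Kempe chain from the right vertex w alternates between a-links (out of right vertices) and
  -- b-links (out of left vertices); exchanging a and b on it frees the colour a at w, and it never
  -- reaches the left vertex u, at which a is already free.
  module KempeSwap (CL : List ColouredLink) (proper : Proper CL) (u w : Fin m) (a b : Fin k)
                   (a∉u : (u , a) ∉ map leftKey CL) (b∉w : (w , b) ∉ map rightKey CL) (a≢b : a ≢ b) where

    Node : Set
    Node = Fin m ⊎ Fin m

    step : Fin k → Node → Maybe Node
    step γ (inj₁ l) = Maybe.map inj₂ (partner left right γ l CL)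
    step γ (inj₂ r) = Maybe.map inj₁ (partner right left γ r CL)

    step-left-sound : ∀ γ l q → step γ (inj₁ l) ≡ just q →
      Σ ColouredLink λ y → y ∈ CL × left y ≡ l × colour y ≡ γ × q ≡ inj₂ (right y)
    step-left-sound γ l q stepped with partner left right γ l CL in found
    ... | just r with partner-sound left right γ l CL r found
    ...   | y , y∈ , left≡ , colour≡ , refl = y , y∈ , left≡ , colour≡ , sym (Maybe.just-injective stepped)

    step-right-sound : ∀ γ r q → step γ (inj₂ r) ≡ just q →
      Σ ColouredLink λ y → y ∈ CL × right y ≡ r × colour y ≡ γ × q ≡ inj₁ (left y)
    step-right-sound γ r q stepped with partner right left γ r CL in found
    ... | just l with partner-sound right left γ r CL l found
    ...   | y , y∈ , right≡ , colour≡ , refl = y , y∈ , right≡ , colour≡ , sym (Maybe.just-injective stepped)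

    step-left-complete : ∀ γ y → y ∈ CL → colour y ≡ γ → step γ (inj₁ (left y)) ≡ just (inj₂ (right y))
    step-left-complete γ y y∈ colour≡ rewrite partner-complete left right γ CL y (proj₁ proper) y∈ colour≡ = refl

    step-right-complete : ∀ γ y → y ∈ CL → colour y ≡ γ → step γ (inj₂ (right y)) ≡ just (inj₁ (left y))
    step-right-complete γ y y∈ colour≡ rewrite partner-complete right left γ CL y (proj₂ proper) y∈ colour≡ = refl

    step-involutive : ∀ γ p q → step γ p ≡ just q → step γ q ≡ just p
    step-involutive γ (inj₁ l) q stepped with step-left-sound γ l q stepped
    ... | y , y∈ , refl , colour≡ , refl = step-right-complete γ y y∈ colour≡
    step-involutive γ (inj₂ r) q stepped with step-right-sound γ r q stepped
    ... | y , y∈ , refl , colour≡ , refl = step-left-complete γ y y∈ colour≡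

    isRight : Node → Bool
    isRight (inj₁ _) = false
    isRight (inj₂ _) = true

    step-flips-side : ∀ γ p q → step γ p ≡ just q → isRight q ≡ not (isRight p)
    step-flips-side γ (inj₁ l) q stepped with step-left-sound γ l q stepped
    ... | _ , _ , _ , _ , refl = refl
    step-flips-side γ (inj₂ r) q stepped with step-right-sound γ r q stepped
    ... | _ , _ , _ , _ , refl = refl

    isEven : ℕ → Bool
    isEven zero = true
    isEven (suc j) = not (isEven j)

    colourAt : ℕ → Fin k
    colourAt j = if isEven j then a else b

    chain : ℕ → Maybe Node
    chain zero = just (inj₂ w)
    chain (suc j) = chain j Maybe.>>= step (colourAt j)

    chain-suc : ∀ j q → chain (suc j) ≡ just q → Σ Node λ p → chain j ≡ just p × step (colourAt j) p ≡ just q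
    chain-suc j q reached with chain j
    ... | just p = p , refl , reached

    chain-step : ∀ j p q → chain j ≡ just p → step (colourAt j) p ≡ just q → chain (suc j) ≡ just q
    chain-step j p q reached stepped rewrite reached = stepped

    chain-side : ∀ j p → chain j ≡ just p → isRight p ≡ isEven j
    chain-side zero p refl = refl
    chain-side (suc j) p reached with chain-suc j p reached
    ... | p′ , reached′ , stepped = ≡-trans (step-flips-side _ p′ p stepped) (cong not (chain-side j p′ reached′))

    colourOutOf colourInto : Node → Fin k
    colourOutOf (inj₁ _) = b
    colourOutOf (inj₂ _) = a
    colourInto (inj₁ _) = a
    colourInto (inj₂ _) = b

    colourAt-outOf : ∀ j p → chain j ≡ just p → colourAt j ≡ colourOutOf p
    colourAt-outOf j (inj₁ _) reached = cong (if_then a else b) (sym (chain-side j _ reached))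
    colourAt-outOf j (inj₂ _) reached = cong (if_then a else b) (sym (chain-side j _ reached))

    colourAt-into : ∀ j p → chain (suc j) ≡ just p → colourAt j ≡ colourInto p
    colourAt-into j (inj₁ _) reached = cong (if_then a else b) (not-injective (sym (chain-side (suc j) _ reached)))
    colourAt-into j (inj₂ _) reached = cong (if_then a else b) (not-injective (sym (chain-side (suc j) _ reached)))

    chain-injective : ∀ i j p → i < j → chain i ≡ just p → chain j ≡ just p → ⊥
    chain-injective zero (suc j) p _ refl reached with chain-suc j (inj₂ w) reached
    ... | q , _ , stepped
      with step-right-sound b w q (step-involutive b q (inj₂ w) (subst (λ γ → step γ q ≡ just (inj₂ w)) (colourAt-into j _ reached) stepped))
    ...   | y , y∈ , right≡w , colour≡b , _ = b∉w (subst (_∈ map rightKey CL) (cong₂ _,_ right≡w colour≡b) (∈-map⁺ rightKey y∈))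
    chain-injective (suc i) (suc j) p (s≤s i<j) reachedᵢ reachedⱼ with chain-suc i p reachedᵢ | chain-suc j p reachedⱼ
    ... | qᵢ , reachedᵢ′ , steppedᵢ | qⱼ , reachedⱼ′ , steppedⱼ =
      chain-injective i j qᵢ i<j reachedᵢ′ (subst (λ q → chain j ≡ just q) (sym qᵢ≡qⱼ) reachedⱼ′)
      where
        steppedⱼ′ : step (colourAt i) qⱼ ≡ just p
        steppedⱼ′ = subst (λ γ → step γ qⱼ ≡ just p) (≡-trans (colourAt-into j p reachedⱼ) (sym (colourAt-into i p reachedᵢ))) steppedⱼ
        qᵢ≡qⱼ : qᵢ ≡ qⱼ
        qᵢ≡qⱼ = Maybe.just-injective (≡-trans (sym (step-involutive _ _ _ steppedᵢ)) (step-involutive _ _ _ steppedⱼ′))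

    chain-prefix : ∀ i j p → i ≤ j → chain j ≡ just p → Σ Node λ q → chain i ≡ just q
    chain-prefix i j p i≤j reached = go (j ∸ i) p (subst (λ t → chain t ≡ just p) (sym (m∸n+n≡m i≤j)) reached)
      where
        go : ∀ d p → chain (d + i) ≡ just p → Σ Node λ q → chain i ≡ just q
        go zero p reached = p , reached
        go (suc d) p reached with chain-suc (d + i) p reached
        ... | q , reached′ , _ = go d q reached′

    encode : Node → Fin (m + m)
    encode = join m m

    encode-injective : ∀ {p q} → encode p ≡ encode q → p ≡ q
    encode-injective {p} {q} eq = ≡-trans (sym (splitAt-join m m p)) (≡-trans (cong (splitAt m) eq) (splitAt-join m m q))

    chain-bound : ∀ j p → chain j ≡ just p → j < m + m
    chain-bound j p reached with j <? m + m
    ... | yes j<2m = j<2m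
    ... | no j≮2m = ⊥-elim (n≮n (m + m) (injective⇒≤ {f = encode ∘ node} node-injective))
      where
        prefix : (i : Fin (suc (m + m))) → Σ Node λ q → chain (toℕ i) ≡ just q
        prefix i = chain-prefix (toℕ i) j p (≤-trans (s≤s⁻¹ (toℕ<n i)) (≮⇒≥ j≮2m)) reached
        node : Fin (suc (m + m)) → Node
        node i = proj₁ (prefix i)
        node-injective : ∀ {i i′} → encode (node i) ≡ encode (node i′) → i ≡ i′
        node-injective {i} {i′} eq with <-cmp (toℕ i) (toℕ i′)
        ... | tri< i<i′ _ _ = ⊥-elim (chain-injective _ _ (node i′) i<i′
                (subst (λ q → chain (toℕ i) ≡ just q) (encode-injective eq) (proj₂ (prefix i))) (proj₂ (prefix i′)))
        ... | tri≈ _ i≡i′ _ = toℕ-injective i≡i′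
        ... | tri> _ _ i>i′ = ⊥-elim (chain-injective _ _ (node i) i>i′
                (subst (λ q → chain (toℕ i′) ≡ just q) (sym (encode-injective eq)) (proj₂ (prefix i′))) (proj₂ (prefix i)))

    OnChain : Node → Set
    OnChain p = Σ (Fin (m + m)) λ j → chain (toℕ j) ≡ just p

    OnChain? : ∀ p → Dec (OnChain p)
    OnChain? p = anyᶠ? (λ j → Maybe.≡-dec (Sum.≡-dec _≟ᶠ_ _≟ᶠ_) (chain (toℕ j)) (just p))

    onChain : ∀ j p → chain j ≡ just p → OnChain p
    onChain j p reached = fromℕ< (chain-bound j p reached) , subst (λ t → chain t ≡ just p) (sym (toℕ-fromℕ< (chain-bound j p reached))) reached

    IsAB : Fin k → Set
    IsAB c = c ≡ a ⊎ c ≡ b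

    entered-left : ∀ j l → chain j ≡ just (inj₁ l) → Σ ℕ λ j′ → Σ Node λ q → chain j′ ≡ just q × step a (inj₁ l) ≡ just q
    entered-left zero l ()
    entered-left (suc j) l reached with chain-suc j (inj₁ l) reached
    ... | q , reached′ , stepped =
      j , q , reached′ , step-involutive a q (inj₁ l) (subst (λ γ → step γ q ≡ just (inj₁ l)) (colourAt-into j _ reached) stepped)

    entered-right : ∀ j r → chain j ≡ just (inj₂ r) →
      r ≡ w ⊎ (Σ ℕ λ j′ → Σ Node λ q → chain j′ ≡ just q × step b (inj₂ r) ≡ just q)
    entered-right zero r refl = inj₁ refl
    entered-right (suc j) r reached with chain-suc j (inj₂ r) reached
    ... | q , reached′ , stepped =
      inj₂ (j , q , reached′ , step-involutive b q (inj₂ r) (subst (λ γ → step γ q ≡ just (inj₂ r)) (colourAt-into j _ reached) stepped))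

    onChain-left⇒right : ∀ y → y ∈ CL → IsAB (colour y) → OnChain (inj₁ (left y)) → OnChain (inj₂ (right y))
    onChain-left⇒right y y∈ (inj₁ colour≡a) (j , reached) with entered-left (toℕ j) (left y) reached
    ... | j′ , q , reached′ , stepped =
      onChain j′ _ (subst (λ q → chain j′ ≡ just q)
        (Maybe.just-injective (≡-trans (sym stepped) (step-left-complete a y y∈ colour≡a))) reached′)
    onChain-left⇒right y y∈ (inj₂ colour≡b) (j , reached) =
      onChain (suc (toℕ j)) _ (chain-step (toℕ j) _ _ reached
        (subst (λ γ → step γ (inj₁ (left y)) ≡ just (inj₂ (right y))) (sym (colourAt-outOf (toℕ j) _ reached))
          (step-left-complete b y y∈ colour≡b)))

    onChain-right⇒left : ∀ y → y ∈ CL → IsAB (colour y) → OnChain (inj₂ (right y)) → OnChain (inj₁ (left y))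
    onChain-right⇒left y y∈ (inj₁ colour≡a) (j , reached) =
      onChain (suc (toℕ j)) _ (chain-step (toℕ j) _ _ reached
        (subst (λ γ → step γ (inj₂ (right y)) ≡ just (inj₁ (left y))) (sym (colourAt-outOf (toℕ j) _ reached))
          (step-right-complete a y y∈ colour≡a)))
    onChain-right⇒left y y∈ (inj₂ colour≡b) (j , reached) with entered-right (toℕ j) (right y) reached
    ... | inj₁ right≡w = ⊥-elim (b∉w (subst (_∈ map rightKey CL) (cong₂ _,_ right≡w colour≡b) (∈-map⁺ rightKey y∈)))
    ... | inj₂ (j′ , q , reached′ , stepped) =
      onChain j′ _ (subst (λ q → chain j′ ≡ just q)
        (Maybe.just-injective (≡-trans (sym stepped) (step-right-complete b y y∈ colour≡b))) reached′)

    Swapped : ColouredLink → Set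
    Swapped y = IsAB (colour y) × OnChain (inj₁ (left y))

    Swapped? : ∀ y → Dec (Swapped y)
    Swapped? y = ((colour y ≟ᶠ a) ⊎-dec (colour y ≟ᶠ b)) ×-dec OnChain? _

    swapAB : Fin k → Fin k
    swapAB c with c ≟ᶠ a | c ≟ᶠ b
    ... | yes _ | _ = b
    ... | no _ | yes _ = a
    ... | no _ | no _ = c

    swapAB-IsAB : ∀ c → IsAB c → IsAB (swapAB c)
    swapAB-IsAB c c∈ab with c ≟ᶠ a | c ≟ᶠ b
    ... | yes _ | _ = inj₂ refl
    ... | no _ | yes _ = inj₁ refl
    ... | no c≢a | no c≢b = ⊥-elim ([ c≢a , c≢b ]′ c∈ab)

    swapAB≡a⇒≡b : ∀ c → swapAB c ≡ a → c ≡ b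
    swapAB≡a⇒≡b c swapped with c ≟ᶠ a | c ≟ᶠ b
    ... | yes _ | _ = ⊥-elim (a≢b (sym swapped))
    ... | no _ | yes c≡b = c≡b
    ... | no c≢a | no _ = ⊥-elim (c≢a swapped)

    swapAB-injective : ∀ c c′ → swapAB c ≡ swapAB c′ → c ≡ c′
    swapAB-injective c c′ eq with c ≟ᶠ a | c ≟ᶠ b | c′ ≟ᶠ a | c′ ≟ᶠ b
    ... | yes c≡a | _ | yes c′≡a | _ = ≡-trans c≡a (sym c′≡a)
    ... | yes _ | _ | no _ | yes _ = ⊥-elim (a≢b (sym eq))
    ... | yes _ | _ | no _ | no c′≢b = ⊥-elim (c′≢b (sym eq))
    ... | no _ | yes _ | yes _ | _ = ⊥-elim (a≢b eq)
    ... | no _ | yes c≡b | no _ | yes c′≡b = ≡-trans c≡b (sym c′≡b)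
    ... | no _ | yes _ | no c′≢a | no _ = ⊥-elim (c′≢a (sym eq))
    ... | no _ | no c≢b | yes _ | _ = ⊥-elim (c≢b eq)
    ... | no c≢a | no _ | no _ | yes _ = ⊥-elim (c≢a eq)
    ... | no _ | no _ | no _ | no _ = eq

    newColour : ColouredLink → Fin k
    newColour y with Swapped? y
    ... | yes _ = swapAB (colour y)
    ... | no _ = colour y

    newColour-swapped : ∀ y → Swapped y → newColour y ≡ swapAB (colour y)
    newColour-swapped y swapped with Swapped? y
    ... | yes _ = refl
    ... | no unswapped = ⊥-elim (unswapped swapped)

    newColour-unswapped : ∀ y → ¬ Swapped y → newColour y ≡ colour y
    newColour-unswapped y unswapped with Swapped? y
    ... | yes swapped = ⊥-elim (unswapped swapped)
    ... | no _ = refl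

    recolour : ColouredLink → ColouredLink
    recolour y = proj₁ y , left y , right y , newColour y

    -- Whether a link is swapped can be read off either of its ends.
    recolour-injectiveOn : (near : ColouredLink → Fin m) (OnChainAt : Fin m → Set) →
      (∀ {y} → y ∈ CL → Swapped y → OnChainAt (near y)) →
      (∀ {y} → y ∈ CL → IsAB (colour y) → OnChainAt (near y) → Swapped y) →
      Unique (map (λ y → near y , colour y) CL) →
      ∀ {y y′} → y ∈ CL → y′ ∈ CL → near y ≡ near y′ → newColour y ≡ newColour y′ → y ≡ y′
    recolour-injectiveOn near OnChainAt swapped⇒ ⇒swapped unique {y} {y′} y∈ y′∈ near≡ colour≡ =
      decide (Swapped? y) (Swapped? y′)
      where
        decide : Dec (Swapped y) → Dec (Swapped y′) → y ≡ y′
        decide (yes s) (yes s′) = Unique-map⇒injectiveOn CL unique y∈ y′∈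
          (cong₂ _,_ near≡ (swapAB-injective _ _ (≡-trans (sym (newColour-swapped y s)) (≡-trans colour≡ (newColour-swapped y′ s′)))))
        decide (no ¬s) (no ¬s′) = Unique-map⇒injectiveOn CL unique y∈ y′∈
          (cong₂ _,_ near≡ (≡-trans (sym (newColour-unswapped y ¬s)) (≡-trans colour≡ (newColour-unswapped y′ ¬s′))))
        decide (yes s) (no ¬s′) = ⊥-elim (¬s′ (⇒swapped y′∈
          (subst IsAB (≡-trans (sym (newColour-swapped y s)) (≡-trans colour≡ (newColour-unswapped y′ ¬s′))) (swapAB-IsAB _ (proj₁ s)))
          (subst OnChainAt near≡ (swapped⇒ y∈ s))))
        decide (no ¬s) (yes s′) = ⊥-elim (¬s (⇒swapped y∈
          (subst IsAB (≡-trans (sym (newColour-swapped y′ s′)) (≡-trans (sym colour≡) (newColour-unswapped y ¬s))) (swapAB-IsAB _ (proj₁ s′)))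
          (subst OnChainAt (sym near≡) (swapped⇒ y′∈ s′))))

    recoloured : List ColouredLink
    recoloured = map recolour CL

    recoloured-proper : Proper recoloured
    recoloured-proper =
      subst Unique (map-∘ CL) (injectiveOn⇒Unique-map unique-CL λ y∈ y′∈ eq →
        recolour-injectiveOn left (OnChain ∘ inj₁) (λ _ → proj₂) (λ _ → _,_) (proj₁ proper) y∈ y′∈ (cong proj₁ eq) (cong proj₂ eq)) ,
      subst Unique (map-∘ CL) (injectiveOn⇒Unique-map unique-CL λ y∈ y′∈ eq →
        recolour-injectiveOn right (OnChain ∘ inj₂) (λ y∈ (ab , on) → onChain-left⇒right _ y∈ ab on)
          (λ y∈ ab on → ab , onChain-right⇒left _ y∈ ab on) (proj₂ proper) y∈ y′∈ (cong proj₁ eq) (cong proj₂ eq))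
      where
        unique-CL : Unique CL
        unique-CL = Unique-map⁻ (proj₁ proper)

    uncoloured-recoloured : map uncoloured recoloured ≡ map uncoloured CL
    uncoloured-recoloured = ≡-trans (sym (map-∘ CL)) (map-cong (λ _ → refl) CL)

    a-free-at-u : (u , a) ∉ map leftKey recoloured
    a-free-at-u ua∈ with ∈-map⁻ (leftKey ∘ recolour) (subst ((u , a) ∈_) (sym (map-∘ CL)) ua∈)
    ... | y , y∈ , eq = decide (Swapped? y)
      where
        decide : Dec (Swapped y) → ⊥
        decide (yes (_ , j , reached)) with entered-left (toℕ j) (left y) reached
        ... | _ , q , _ , stepped with step-left-sound a (left y) q stepped
        ...   | y′ , y′∈ , left≡ , colour≡a , _ =
          a∉u (subst (_∈ map leftKey CL) (cong₂ _,_ (≡-trans left≡ (sym (cong proj₁ eq))) colour≡a) (∈-map⁺ leftKey y′∈))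
        decide (no unswapped) =
          a∉u (subst (_∈ map leftKey CL) (sym (≡-trans eq (cong (left y ,_) (newColour-unswapped y unswapped)))) (∈-map⁺ leftKey y∈))

    a-free-at-w : (w , a) ∉ map rightKey recoloured
    a-free-at-w wa∈ with ∈-map⁻ (rightKey ∘ recolour) (subst ((w , a) ∈_) (sym (map-∘ CL)) wa∈)
    ... | y , y∈ , eq = decide (Swapped? y)
      where
        decide : Dec (Swapped y) → ⊥
        decide (yes swapped) = b∉w (subst (_∈ map rightKey CL)
          (cong₂ _,_ (sym (cong proj₁ eq)) (swapAB≡a⇒≡b (colour y) (≡-trans (sym (newColour-swapped y swapped)) (sym (cong proj₂ eq)))))
          (∈-map⁺ rightKey y∈))
        decide (no unswapped) =
          unswapped (inj₁ colour≡a , onChain-right⇒left y y∈ (inj₁ colour≡a) (onChain 0 _ (cong (just ∘ inj₂) (cong proj₁ eq))))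
          where
            colour≡a : colour y ≡ a
            colour≡a = ≡-trans (sym (newColour-unswapped y unswapped)) (sym (cong proj₂ eq))

    kempeSwap : Σ (List ColouredLink) λ L → map uncoloured L ≡ map uncoloured CL × Proper L × (u , a) ∉ map leftKey L × (w , a) ∉ map rightKey L
    kempeSwap = recoloured , uncoloured-recoloured , recoloured-proper , a-free-at-u , a-free-at-w

  open Occurrences (_≟ᶠ_ {m})
  open ColourCounting (_≟ᶠ_ {m}) k using (missingColour)
  open DecMembership (Product.≡-dec (_≟ᶠ_ {m}) (_≟ᶠ_ {k})) using (_∈?_)

  leftEnd rightEnd : Link → Fin m
  leftEnd (_ , l , _) = l
  rightEnd (_ , _ , r) = r

  colourWith : Link → Fin k → ColouredLink
  colourWith (λ′ , l , r) c = λ′ , l , r , c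

  leftKeys : ∀ L → map proj₁ (map leftKey L) ≡ map leftEnd (map uncoloured L)
  leftKeys [] = refl
  leftKeys (y ∷ L) = cong (left y ∷_) (leftKeys L)

  rightKeys : ∀ L → map proj₁ (map rightKey L) ≡ map rightEnd (map uncoloured L)
  rightKeys [] = refl
  rightKeys (y ∷ L) = cong (right y ∷_) (rightKeys L)

  addLink : ∀ x CL → Proper CL → (a b : Fin k) → (leftEnd x , a) ∉ map leftKey CL → (rightEnd x , b) ∉ map rightKey CL →
    Σ (List ColouredLink) λ CL′ → map uncoloured CL′ ≡ x ∷ map uncoloured CL × Proper CL′
  addLink x CL proper a b a∉ˡ b∉ʳ with (rightEnd x , a) ∈? map rightKey CL
  ... | no a∉ʳ = (colourWith x a ∷ CL) , refl , unique-∷ a∉ˡ (proj₁ proper) , unique-∷ a∉ʳ (proj₂ proper)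
  ... | yes a∈ʳ with KempeSwap.kempeSwap CL proper (leftEnd x) (rightEnd x) a b a∉ˡ b∉ʳ (λ { refl → b∉ʳ a∈ʳ })
  ...   | CL′ , same , proper′ , a∉ˡ′ , a∉ʳ′ =
    (colourWith x a ∷ CL′) , cong (x ∷_) same , unique-∷ a∉ˡ′ (proj₁ proper′) , unique-∷ a∉ʳ′ (proj₂ proper′)

  konig : ∀ X → (∀ v → occ v (map leftEnd X) ≤ k) → (∀ v → occ v (map rightEnd X) ≤ k) →
    Σ (List ColouredLink) λ CL → map uncoloured CL ≡ X × Proper CL
  konig [] _ _ = [] , refl , [] , []
  konig (x ∷ X) degˡ degʳ with konig X (λ v → ≤-trans (m≤n+m _ _) (degˡ v)) (λ v → ≤-trans (m≤n+m _ _) (degʳ v))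
  ... | CL , refl , proper
    with missingColour (map leftKey CL) (leftEnd x)
           (subst₂ (λ n L → n + occ (leftEnd x) L ≤ k) (δ-refl (leftEnd x)) (sym (leftKeys CL)) (degˡ (leftEnd x)))
       | missingColour (map rightKey CL) (rightEnd x)
           (subst₂ (λ n L → n + occ (rightEnd x) L ≤ k) (δ-refl (rightEnd x)) (sym (rightKeys CL)) (degʳ (rightEnd x)))
  ... | a , a∉ˡ | b , b∉ʳ = addLink x CL proper a b a∉ˡ b∉ʳ

-- Transitions and trails in hypergraphs

module TransitionSystem (H : Hypergraph) (evenDegrees : (v : Vertex H) → 2 ∣ degree H v) where

  incident : Vertex H → Edge H → Bool
  incident v e = Vec.lookup (inc H e) v

  edgesAt : Vertex H → List (Edge H)
  edgesAt v = filterᵇ (incident v) (allFin (nE H))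

  verticesOf : Edge H → List (Vertex H)
  verticesOf e = filterᵇ (λ v → incident v e) (allFin (nV H))

  length-edgesAt : ∀ v → length (edgesAt v) ≡ degree H v
  length-edgesAt v = length-filterᵇ-tabulate id (incident v) (Vec.tabulate (incident v)) (λ e → sym (lookup∘tabulate (incident v) e))

  length-verticesOf : ∀ e → length (verticesOf e) ≡ ∣ inc H e ∣
  length-verticesOf e = length-filterᵇ-tabulate id (λ v → incident v e) (inc H e) (λ _ → refl)

  Transition : Set
  Transition = Vertex H × Edge H × Edge H

  transitionsAt : Vertex H → List Transition
  transitionsAt v = map (v ,_) (pairUp (edgesAt v))

  transitions : List Transition
  transitions = concatMap transitionsAt (allFin (nV H))

  flagsOf : Transition → List (Vertex H × Edge H)
  flagsOf (v , e , e′) = (v , e) ∷ (v , e′) ∷ []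

  flagsAt : Vertex H → List (Vertex H × Edge H)
  flagsAt v = map (v ,_) (edgesAt v)

  flags : List (Vertex H × Edge H)
  flags = concatMap flagsAt (allFin (nV H))

  flagsOf-transitionsAt : ∀ v es → 2 ∣ length es → concatMap flagsOf (map (v ,_) (pairUp es)) ≡ map (v ,_) es
  flagsOf-transitionsAt v [] _ = refl
  flagsOf-transitionsAt v (e ∷ []) 2∣1 with () ← ∣1⇒≡1 2∣1
  flagsOf-transitionsAt v (e ∷ e′ ∷ es) 2∣2+ =
    cong (λ fs → (v , e) ∷ (v , e′) ∷ fs) (flagsOf-transitionsAt v es (∣m+n∣m⇒∣n 2∣2+ (divides 1 refl)))

  flagsOf-transitions : concatMap flagsOf transitions ≡ flags
  flagsOf-transitions = begin
    concatMap flagsOf (concatMap transitionsAt (allFin (nV H)))      ≡⟨ concatMap-concatMap flagsOf transitionsAt (allFin (nV H)) ⟩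
    concatMap (concatMap flagsOf ∘ transitionsAt) (allFin (nV H))
      ≡⟨ concatMap-cong (λ v → flagsOf-transitionsAt v (edgesAt v) (subst (2 ∣_) (sym (length-edgesAt v)) (evenDegrees v))) (allFin (nV H)) ⟩
    flags                                                            ∎
    where open ≡-Reasoning

  unique-flags : Unique flags
  unique-flags = Unique-concatMap⁺ flagsAt proj₁ (allFin⁺ (nV H))
    (λ v → All.tabulate λ f∈ → cong proj₁ (proj₂ (proj₂ (∈-map⁻ (v ,_) f∈))))
    (λ v → Unique-map⁺ (cong proj₂) (filter⁺ (T? ∘ incident v) (allFin⁺ (nE H))))

  IsFlag⇒∈flags : ∀ {f} → IsFlag H f → f ∈ flags
  IsFlag⇒∈flags {v , e} v∈e =
    ∈-concatMap⁺′ flagsAt (∈-allFin v)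
      (∈-map⁺ (v ,_) (∈-filter⁺ (T? ∘ incident v) (∈-allFin e) (Equivalence.from T-≡ ([]=⇒lookup v∈e))))

  ∈flags⇒IsFlag : ∀ {f} → f ∈ flags → IsFlag H f
  ∈flags⇒IsFlag f∈ with ∈-concatMap⁻′ flagsAt (allFin (nV H)) f∈
  ... | v , _ , f∈at with ∈-map⁻ (v ,_) f∈at
  ... | e , e∈ , refl = lookup⇒[]= v (inc H e) (Equivalence.to T-≡ (proj₂ (∈-filter⁻ (T? ∘ incident v) {xs = allFin (nE H)} e∈)))

module HypergraphTrails (H : Hypergraph) where

  module G = EulerFamilies {V = Vertex H} {E = Edge H} _≟ᶠ_

  IsStep : G.Arc → Set
  IsStep (e , y , z) = y ≢ z × IsFlag H (y , e) × IsFlag H (z , e)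

  IsStep-reversed : ∀ {o} → IsStep o → IsStep (G.reversed o)
  IsStep-reversed (y≢z , y∈e , z∈e) = y≢z ∘ sym , z∈e , y∈e

  isWalkFrom : ∀ v s → (∀ {o} → o ∈ G.arcsFrom v s → IsStep o) → IsWalkFrom H v s
  isWalkFrom v [] _ = _
  isWalkFrom v ((e , w) ∷ s) steps =
    let v≢w , v∈e , w∈e = steps (here refl) in v≢w , v∈e , w∈e , isWalkFrom w s (steps ∘ there)

  lastFrom≡endpoint : ∀ v s → lastFrom H v s ≡ G.endpoint v s
  lastFrom≡endpoint v [] = refl
  lastFrom≡endpoint v ((e , w) ∷ s) = lastFrom≡endpoint w s

  -- A closed trail of length one would be a loop, which no step is.
  isClosed : ∀ t → G.Closed t → (∀ {o} → o ∈ G.arcs t → IsStep o) → IsClosed H t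
  isClosed (v , []) (s≢[] , _) _ = ⊥-elim (s≢[] refl)
  isClosed (v , (e , w) ∷ []) (_ , returns) steps = ⊥-elim (proj₁ (steps (here refl)) (sym returns))
  isClosed (v , s@(_ ∷ _ ∷ _)) (_ , returns) _ = s≤s (s≤s z≤n) , sym (≡-trans (lastFrom≡endpoint v s) returns)

  edgesOf≡labels : ∀ t → edgesOf H t ≡ G.labels (G.arcs t)
  edgesOf≡labels (v , s) = sym (G.labels-arcsFrom v s)

  anchorFlagsOf : G.Arc → List (Vertex H × Edge H)
  anchorFlagsOf (e , y , z) = (y , e) ∷ (z , e) ∷ []

  anchorFlags≡ : ∀ v s → anchorFlagsFrom H v s ≡ concatMap anchorFlagsOf (G.arcsFrom v s)
  anchorFlags≡ v [] = refl
  anchorFlags≡ v ((e , w) ∷ s) = cong (λ fs → (v , e) ∷ (w , e) ∷ fs) (anchorFlags≡ w s)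

  module FromGraph {gs : List G.Arc} {F : List G.Trail} (family : G.IsEulerFamilyOf gs F)
                   (unique : Unique (G.labels gs)) (covers : ∀ e → e ∈ G.labels gs) (steps : All IsStep gs) where

    open G.IsEulerFamilyOf family

    labels-arcsOf : G.labels (G.arcsOf F) ≡ concatMap (edgesOf H) F
    labels-arcsOf = ≡-trans (map-concatMap proj₁ G.arcs F) (concatMap-cong (sym ∘ edgesOf≡labels) F)

    unique-edges : Unique (concatMap (edgesOf H) F)
    unique-edges = subst Unique labels-arcsOf (Unique-resp-↭ (↭-sym labels↭) unique)

    arc-step : ∀ {t} → t ∈ F → ∀ {o} → o ∈ G.arcs t → IsStep o
    arc-step t∈ o∈ with oriented (∈-concatMap⁺′ G.arcs t∈ o∈)
    ... | inj₁ o∈gs = All.lookup steps o∈gs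
    ... | inj₂ o′∈gs = IsStep-reversed (All.lookup steps o′∈gs)

    trail-of : ∀ e → Any (λ t → e ∈ edgesOf H t) F
    trail-of e = ∈-concatMap⁻ (edgesOf H) (subst (e ∈_) labels-arcsOf (∈-resp-↭ (↭-sym labels↭) (covers e)))

    closedStrictTrails : All (IsClosedStrictTrail H) F
    closedStrictTrails = All.tabulate λ {t} t∈ →
      isWalkFrom (proj₁ t) (proj₂ t) (arc-step t∈) , isClosed t (All.lookup closed t∈) (arc-step t∈) ,
      Unique-concatMap⇒Unique (edgesOf H) F unique-edges t∈

    anchorDisjoint : ∀ i j → i ≢ j → AnchorDisjoint H (lookup F i) (lookup F j)
    anchorDisjoint i j i≢j x x∈ = AllPairs-lookup {R = G.VisitDisjoint} (λ t#u x∈u x∈t → t#u x∈t x∈u) disjoint i j i≢j x∈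

    coveredOnce : ∀ e → Σ (Fin (length F)) λ i → e ∈ edgesOf H (lookup F i) × (∀ j → e ∈ edgesOf H (lookup F j) → j ≡ i)
    coveredOnce e = index (trail-of e) , lookup-index (trail-of e) ,
      λ j e∈ → Unique-concatMap⇒lookup-injective (edgesOf H) F unique-edges j (index (trail-of e)) e∈ (lookup-index (trail-of e))

    isEulerFamily : IsEulerFamily H F
    isEulerFamily = closedStrictTrails , anchorDisjoint , coveredOnce

    anchorFlagsOf↭ : concatMap anchorFlagsOf (G.arcsOf F) ↭ concatMap anchorFlagsOf gs
    anchorFlagsOf↭ = G.concatMap-arcsOf anchorFlagsOf (λ _ → swap _ _ ↭-refl) unique family

    anchorFlags-arcsOf : concatMap anchorFlagsOf (G.arcsOf F) ≡ concatMap (anchorFlags H) F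
    anchorFlags-arcsOf = ≡-trans (concatMap-concatMap anchorFlagsOf G.arcs F) (concatMap-cong (λ t → sym (anchorFlags≡ (proj₁ t) (proj₂ t))) F)

    IsAnchorFlagOf⇒∈ : ∀ {f} → IsAnchorFlagOf H f F → f ∈ concatMap anchorFlagsOf gs
    IsAnchorFlagOf⇒∈ (i , f∈) =
      ∈-resp-↭ anchorFlagsOf↭ (subst (_ ∈_) (sym anchorFlags-arcsOf) (∈-concatMap⁺′ (anchorFlags H) {xs = F} (∈-lookup i) f∈))

    ∈⇒IsAnchorFlagOf : ∀ {f} → f ∈ concatMap anchorFlagsOf gs → IsAnchorFlagOf H f F
    ∈⇒IsAnchorFlagOf {f} f∈ = index found , lookup-index found
      where
        found : Any (λ t → f ∈ anchorFlags H t) F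
        found = ∈-concatMap⁻ (anchorFlags H) (subst (_ ∈_) anchorFlags-arcsOf (∈-resp-↭ (↭-sym anchorFlagsOf↭) f∈))

module ColouredEulerFamilies (k : ℕ) (H : Hypergraph) (uniform : Uniform H (2 * k)) (evenDegrees : (v : Vertex H) → 2 ∣ degree H v) where

  open TransitionSystem H evenDegrees
  open Occurrences (_≟ᶠ_ {nE H})
  module T = EulerFamilies {V = Edge H} {E = Transition} _≟ᶠ_

  transitionArc : Transition → T.Arc
  transitionArc t = t , proj₂ t

  transitionGraph : List T.Arc
  transitionGraph = map transitionArc transitions

  endsOf-transitionGraph : T.endsOf transitionGraph ≡ concatMap edgesAt (allFin (nV H))
  endsOf-transitionGraph = begin
    T.endsOf (map transitionArc transitions)       ≡⟨ concatMap-map T.ends transitionArc transitions ⟩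
    concatMap (map proj₂ ∘ flagsOf) transitions   ≡⟨ sym (map-concatMap proj₂ flagsOf transitions) ⟩
    map proj₂ (concatMap flagsOf transitions)     ≡⟨ cong (map proj₂) flagsOf-transitions ⟩
    map proj₂ flags                               ≡⟨ map-concatMap proj₂ flagsAt (allFin (nV H)) ⟩
    concatMap (map proj₂ ∘ flagsAt) (allFin (nV H)) ≡⟨ concatMap-cong (λ v → map-inverse (λ _ → refl) (edgesAt v)) (allFin (nV H)) ⟩
    concatMap edgesAt (allFin (nV H))             ∎
    where open ≡-Reasoning

  occ-edgesAt : ∀ e → occ e (concatMap edgesAt (allFin (nV H))) ≡ 2 * k
  occ-edgesAt e = begin
    occ e (concatMap edgesAt (allFin (nV H)))               ≡⟨ occ-concatMap e edgesAt (allFin (nV H)) ⟩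
    sum (map (occ e ∘ edgesAt) (allFin (nV H)))
      ≡⟨ cong sum (map-cong (λ v → occ-filterᵇ e (allFin (nE H)) (allFin⁺ (nE H)) (∈-allFin e)) (allFin (nV H))) ⟩
    sum (map (λ v → if incident v e then 1 else 0) (allFin (nV H))) ≡⟨ sum-indicators (λ v → incident v e) (allFin (nV H)) ⟩
    length (verticesOf e)                                   ≡⟨ length-verticesOf e ⟩
    ∣ inc H e ∣                                              ≡⟨ uniform e ⟩
    2 * k                                                   ∎
    where open ≡-Reasoning

  unique-flagsOf-transitions : Unique (concatMap flagsOf transitions)
  unique-flagsOf-transitions = subst Unique (sym flagsOf-transitions) unique-flags

  labels-transitionGraph : T.labels transitionGraph ≡ transitions
  labels-transitionGraph = map-inverse (λ _ → refl) transitions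

  unique-labels-transitionGraph : Unique (T.labels transitionGraph)
  unique-labels-transitionGraph = subst Unique (sym labels-transitionGraph)
    (Unique-concatMap⁻ flagsOf transitions (λ t → _ , here refl) unique-flagsOf-transitions)

  transitionGraph-even : T.EvenGraph transitionGraph
  transitionGraph-even = unique-labels-transitionGraph , All.tabulate nonLoop ,
    λ e → subst (2 ∣_) (sym (≡-trans (cong (occ e) endsOf-transitionGraph) (occ-edgesAt e))) (divides k (*-comm 2 k))
    where
      nonLoop : ∀ {o} → o ∈ transitionGraph → T.NonLoop o
      nonLoop o∈ with ∈-map⁻ transitionArc o∈
      ... | t , t∈ , refl = λ e≡e′ →
        Unique[x∷xs]⇒x∉xs (Unique-concatMap⇒Unique flagsOf transitions unique-flagsOf-transitions t∈) (here (cong (proj₁ t ,_) e≡e′))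

  opaque
    orientation : Σ (List T.Trail) (T.IsEulerFamilyOf transitionGraph)
    orientation = T.eulerFamily transitionGraph transitionGraph-even

  orientedTransitions : List T.Arc
  orientedTransitions = T.arcsOf (proj₁ orientation)

  occ-sources : ∀ e → occ e (map T.source orientedTransitions) ≡ k
  occ-sources e = n+n≡m+m⇒n≡m _ _ (begin
    occ e (map T.source orientedTransitions) + occ e (map T.source orientedTransitions)
      ≡⟨ T.occ-sources-half unique-labels-transitionGraph (proj₂ orientation) e ⟩
    occ e (T.endsOf transitionGraph)             ≡⟨ cong (occ e) endsOf-transitionGraph ⟩
    occ e (concatMap edgesAt (allFin (nV H)))    ≡⟨ occ-edgesAt e ⟩
    k + (k + 0)                                  ≡⟨ cong (k +_) (+-identityʳ k) ⟩
    k + k                                        ∎)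
    where open ≡-Reasoning

  occ-targets : ∀ e → occ e (map T.target orientedTransitions) ≡ k
  occ-targets e = ≡-trans (sym (occ-resp-↭ e (T.sources↭targets (T.IsEulerFamilyOf.closed (proj₂ orientation))))) (occ-sources e)

  module B = BipartiteEdgeColouring {Λ = Transition} (nE H) k
  open ColourCounting (_≟ᶠ_ {nE H}) k using (allColoursPresent)

  opaque
    colouring : Σ (List B.ColouredLink) λ CL → map B.uncoloured CL ≡ orientedTransitions × B.Proper CL
    colouring = B.konig orientedTransitions (≤-reflexive ∘ occ-sources) (≤-reflexive ∘ occ-targets)

  colouredTransitions : List B.ColouredLink
  colouredTransitions = proj₁ colouring

  proper : B.Proper colouredTransitions
  proper = proj₂ (proj₂ colouring)

  arcFlags : T.Arc → List (Vertex H × Edge H)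
  arcFlags (t , e , e′) = (proj₁ t , e) ∷ (proj₁ t , e′) ∷ []

  linkFlags : B.ColouredLink → List (Vertex H × Edge H)
  linkFlags = arcFlags ∘ B.uncoloured

  linkFlags↭flags : concatMap linkFlags colouredTransitions ↭ flags
  linkFlags↭flags = begin
    concatMap linkFlags colouredTransitions          ≡⟨ sym (concatMap-map arcFlags B.uncoloured colouredTransitions) ⟩
    concatMap arcFlags (map B.uncoloured colouredTransitions) ≡⟨ cong (concatMap arcFlags) (proj₁ (proj₂ colouring)) ⟩
    concatMap arcFlags orientedTransitions
      ↭⟨ T.concatMap-arcsOf arcFlags (λ _ → swap _ _ ↭-refl) unique-labels-transitionGraph (proj₂ orientation) ⟩
    concatMap arcFlags transitionGraph               ≡⟨ concatMap-map arcFlags transitionArc transitions ⟩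
    concatMap flagsOf transitions                    ≡⟨ flagsOf-transitions ⟩
    flags                                            ∎
    where open PermutationReasoning

  unique-linkFlags : Unique (concatMap linkFlags colouredTransitions)
  unique-linkFlags = Unique-resp-↭ (↭-sym linkFlags↭flags) unique-flags

  occ-leftKeys : ∀ e → occ e (map proj₁ (map B.leftKey colouredTransitions)) ≡ k
  occ-leftKeys e = ≡-trans (cong (occ e) (≡-trans (B.leftKeys colouredTransitions) (cong (map B.leftEnd) (proj₁ (proj₂ colouring))))) (occ-sources e)

  occ-rightKeys : ∀ e → occ e (map proj₁ (map B.rightKey colouredTransitions)) ≡ k
  occ-rightKeys e = ≡-trans (cong (occ e) (≡-trans (B.rightKeys colouredTransitions) (cong (map B.rightEnd) (proj₁ (proj₂ colouring))))) (occ-targets e)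

  opaque
    exitLink : ∀ (i : Fin k) e → Σ B.ColouredLink λ y → y ∈ colouredTransitions × B.left y ≡ e × B.colour y ≡ i
    exitLink i e with ∈-map⁻ B.leftKey (allColoursPresent _ e (proj₁ proper) (occ-leftKeys e) i)
    ... | y , y∈ , eq = y , y∈ , sym (cong proj₁ eq) , sym (cong proj₂ eq)

    entryLink : ∀ (i : Fin k) e → Σ B.ColouredLink λ y → y ∈ colouredTransitions × B.right y ≡ e × B.colour y ≡ i
    entryLink i e with ∈-map⁻ B.rightKey (allColoursPresent _ e (proj₂ proper) (occ-rightKeys e) i)
    ... | y , y∈ , eq = y , y∈ , sym (cong proj₁ eq) , sym (cong proj₂ eq)

  vertexOf : B.ColouredLink → Vertex H
  vertexOf y = proj₁ (proj₁ y)

  exit entry : Fin k → Edge H → Vertex H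
  exit i e = vertexOf (proj₁ (exitLink i e))
  entry i e = vertexOf (proj₁ (entryLink i e))

  exit∈linkFlags : ∀ i e → (exit i e , e) ∈ linkFlags (proj₁ (exitLink i e))
  exit∈linkFlags i e = here (cong (exit i e ,_) (sym (proj₁ (proj₂ (proj₂ (exitLink i e))))))

  entry∈linkFlags : ∀ i e → (entry i e , e) ∈ linkFlags (proj₁ (entryLink i e))
  entry∈linkFlags i e = there (here (cong (entry i e ,_) (sym (proj₁ (proj₂ (proj₂ (entryLink i e)))))))

  -- Equal vertices would make (entry i e , e) a flag of both links, forcing them to be one
  -- transition whose two edges are both e.
  entry≢exit : ∀ i e → entry i e ≢ exit i e
  entry≢exit i e entry≡exit =
    let y , y∈ , left≡e , _ = exitLink i e
        y′ , y′∈ , right≡e , _ = entryLink i e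
        y≢y′ : y ≢ y′
        y≢y′ y≡y′ = Unique[x∷xs]⇒x∉xs (Unique-concatMap⇒Unique linkFlags colouredTransitions unique-linkFlags y∈)
          (here (cong (vertexOf y ,_) (≡-trans left≡e (≡-trans (sym right≡e) (cong B.right (sym y≡y′))))))
    in Unique-concatMap⇒disjoint linkFlags colouredTransitions unique-linkFlags y∈ y′∈ y≢y′
         (exit∈linkFlags i e) (subst (λ v → (v , e) ∈ linkFlags y′) entry≡exit (entry∈linkFlags i e))

  colourFlagsAt : Fin k → Edge H → List (Vertex H × Edge H)
  colourFlagsAt i e = (entry i e , e) ∷ (exit i e , e) ∷ []

  colourFlags : Fin k → List (Vertex H × Edge H)
  colourFlags i = concatMap (colourFlagsAt i) (allFin (nE H))

  hasColour? : ∀ i (y : B.ColouredLink) → Dec (B.colour y ≡ i)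
  hasColour? i y = B.colour y ≟ᶠ i

  colourLinks : Fin k → List B.ColouredLink
  colourLinks i = filter (hasColour? i) colouredTransitions

  unique-colourFlags : ∀ i → Unique (colourFlags i)
  unique-colourFlags i = Unique-concatMap⁺ (colourFlagsAt i) proj₂ (allFin⁺ (nE H)) (λ e → refl ∷ refl ∷ [])
    (λ e → unique-∷ (λ { (here eq) → entry≢exit i e (cong proj₁ eq) }) (unique-∷ (λ ()) []))

  unique-colourLinkFlags : ∀ i → Unique (concatMap linkFlags (colourLinks i))
  unique-colourLinkFlags i = Unique-concatMap-filter⁺ linkFlags (hasColour? i) colouredTransitions unique-linkFlags

  colourFlags⊆ : ∀ i {f} → f ∈ colourFlags i → f ∈ concatMap linkFlags (colourLinks i)
  colourFlags⊆ i f∈ with ∈-concatMap⁻′ (colourFlagsAt i) (allFin (nE H)) f∈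
  ... | e , _ , here refl = let y , y∈ , _ , colour≡i = entryLink i e in
    ∈-concatMap⁺′ linkFlags (∈-filter⁺ (hasColour? i) y∈ colour≡i) (entry∈linkFlags i e)
  ... | e , _ , there (here refl) = let y , y∈ , _ , colour≡i = exitLink i e in
    ∈-concatMap⁺′ linkFlags (∈-filter⁺ (hasColour? i) y∈ colour≡i) (exit∈linkFlags i e)

  ⊆colourFlags : ∀ i {f} → f ∈ concatMap linkFlags (colourLinks i) → f ∈ colourFlags i
  ⊆colourFlags i f∈ with ∈-concatMap⁻′ linkFlags (colourLinks i) f∈
  ... | y , y∈′ , f∈y with ∈-filter⁻ (hasColour? i) {xs = colouredTransitions} y∈′
  ... | y∈ , colour≡i with f∈y
  ...   | here refl = ∈-concatMap⁺′ (colourFlagsAt i) (∈-allFin (B.left y)) (there (here (cong (_, B.left y) (cong vertexOf y≡exit))))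
    where
      y≡exit : y ≡ proj₁ (exitLink i (B.left y))
      y≡exit = let _ , y′∈ , left≡ , colour≡ = exitLink i (B.left y) in
        Unique-map⇒injectiveOn colouredTransitions (proj₁ proper) y∈ y′∈ (cong₂ _,_ (sym left≡) (≡-trans colour≡i (sym colour≡)))
  ...   | there (here refl) = ∈-concatMap⁺′ (colourFlagsAt i) (∈-allFin (B.right y)) (here (cong (_, B.right y) (cong vertexOf y≡entry)))
    where
      y≡entry : y ≡ proj₁ (entryLink i (B.right y))
      y≡entry = let _ , y′∈ , right≡ , colour≡ = entryLink i (B.right y) in
        Unique-map⇒injectiveOn colouredTransitions (proj₂ proper) y∈ y′∈ (cong₂ _,_ (sym right≡) (≡-trans colour≡i (sym colour≡)))

  colourFlags↭ : ∀ i → colourFlags i ↭ concatMap linkFlags (colourLinks i)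
  colourFlags↭ i = unique∧set⇒↭ (unique-colourFlags i) (unique-colourLinkFlags i) (colourFlags⊆ i) (⊆colourFlags i)

  open HypergraphTrails H
  module Occᵛ = Occurrences (_≟ᶠ_ {nV H})

  colourGraph : Fin k → List G.Arc
  colourGraph i = map (λ e → e , entry i e , exit i e) (allFin (nE H))

  labels-colourGraph : ∀ i → G.labels (colourGraph i) ≡ allFin (nE H)
  labels-colourGraph i = map-inverse (λ _ → refl) (allFin (nE H))

  anchorFlags-colourGraph : ∀ i → concatMap anchorFlagsOf (colourGraph i) ≡ colourFlags i
  anchorFlags-colourGraph i = concatMap-map anchorFlagsOf _ (allFin (nE H))

  colourFlags⊆flags : ∀ i {f} → f ∈ colourFlags i → f ∈ flags
  colourFlags⊆flags i =
    ∈-resp-↭ linkFlags↭flags ∘ concatMap-mono linkFlags {ys = colouredTransitions} (proj₁ ∘ ∈-filter⁻ (hasColour? i)) ∘ colourFlags⊆ i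

  colourGraph-steps : ∀ i → All IsStep (colourGraph i)
  colourGraph-steps i = All.tabulate step
    where
      step : ∀ {o} → o ∈ colourGraph i → IsStep o
      step o∈ with ∈-map⁻ _ o∈
      ... | e , _ , refl = entry≢exit i e ,
        ∈flags⇒IsFlag (colourFlags⊆flags i (∈-concatMap⁺′ (colourFlagsAt i) (∈-allFin e) (here refl))) ,
        ∈flags⇒IsFlag (colourFlags⊆flags i (∈-concatMap⁺′ (colourFlagsAt i) (∈-allFin e) (there (here refl))))

  endsOf-colourGraph : ∀ i → G.endsOf (colourGraph i) ↭ concatMap (λ y → vertexOf y ∷ vertexOf y ∷ []) (colourLinks i)
  endsOf-colourGraph i = begin
    G.endsOf (colourGraph i)                         ≡⟨ concatMap-map G.ends _ (allFin (nE H)) ⟩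
    concatMap (map proj₁ ∘ colourFlagsAt i) (allFin (nE H)) ≡⟨ sym (map-concatMap proj₁ (colourFlagsAt i) (allFin (nE H))) ⟩
    map proj₁ (colourFlags i)                        ↭⟨ map⁺ proj₁ (colourFlags↭ i) ⟩
    map proj₁ (concatMap linkFlags (colourLinks i))  ≡⟨ map-concatMap proj₁ linkFlags (colourLinks i) ⟩
    concatMap (λ y → vertexOf y ∷ vertexOf y ∷ []) (colourLinks i) ∎
    where open PermutationReasoning

  colourGraph-even : ∀ i → G.EvenGraph (colourGraph i)
  colourGraph-even i =
    subst Unique (sym (labels-colourGraph i)) (allFin⁺ (nE H)) ,
    All.map proj₁ (colourGraph-steps i) ,
    λ v → subst (2 ∣_) (sym (Occᵛ.occ-resp-↭ v (endsOf-colourGraph i))) (Occᵛ.occ-doubled v vertexOf (colourLinks i))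

  opaque
    colourFamily : ∀ i → Σ (List G.Trail) (G.IsEulerFamilyOf (colourGraph i))
    colourFamily i = G.eulerFamily (colourGraph i) (colourGraph-even i)

  module ColourFamily (i : Fin k) = FromGraph (proj₂ (colourFamily i)) (proj₁ (colourGraph-even i))
    (λ e → subst (e ∈_) (sym (labels-colourGraph i)) (∈-allFin e)) (colourGraph-steps i)

  𝓕 : Fin k → Family H
  𝓕 i = proj₁ (colourFamily i)

  isEulerFamily : ∀ i → IsEulerFamily H (𝓕 i)
  isEulerFamily = ColourFamily.isEulerFamily

  anchorFlag⇒colourFlag : ∀ i {f} → IsAnchorFlagOf H f (𝓕 i) → f ∈ colourFlags i
  anchorFlag⇒colourFlag i = subst (_ ∈_) (anchorFlags-colourGraph i) ∘ ColourFamily.IsAnchorFlagOf⇒∈ i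

  colourFlag⇒anchorFlag : ∀ i {f} → f ∈ colourFlags i → IsAnchorFlagOf H f (𝓕 i)
  colourFlag⇒anchorFlag i = ColourFamily.∈⇒IsAnchorFlagOf i ∘ subst (_ ∈_) (sym (anchorFlags-colourGraph i))

  colourOf : ∀ {f} → IsFlag H f → Σ (Fin k) λ i → f ∈ colourFlags i
  colourOf flag with ∈-concatMap⁻′ linkFlags colouredTransitions (∈-resp-↭ (↭-sym linkFlags↭flags) (IsFlag⇒∈flags flag))
  ... | y , y∈ , f∈y = B.colour y , ⊆colourFlags (B.colour y) (∈-concatMap⁺′ linkFlags (∈-filter⁺ (hasColour? (B.colour y)) y∈ refl) f∈y)

  colourOf-unique : ∀ {f} i j → f ∈ colourFlags i → f ∈ colourFlags j → j ≡ i
  colourOf-unique i j f∈i f∈j with i ≟ᶠ j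
  ... | yes i≡j = sym i≡j
  ... | no i≢j
    with ∈-concatMap⁻′ linkFlags (colourLinks i) (colourFlags⊆ i f∈i) | ∈-concatMap⁻′ linkFlags (colourLinks j) (colourFlags⊆ j f∈j)
  ... | y , y∈ , f∈y | y′ , y′∈ , f∈y′
    with ∈-filter⁻ (hasColour? i) {xs = colouredTransitions} y∈ | ∈-filter⁻ (hasColour? j) {xs = colouredTransitions} y′∈
  ... | y∈CL , colour≡i | y′∈CL , colour≡j = ⊥-elim (Unique-concatMap⇒disjoint linkFlags colouredTransitions unique-linkFlags y∈CL y′∈CL
    (λ { refl → i≢j (≡-trans (sym colour≡i) colour≡j) }) f∈y f∈y′)

mainTheorem10 : (k : ℕ) → 1 ≤ k → (H : Hypergraph) → Uniform H (2 * k)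
    → ((v : Vertex H) → 2 ∣ degree H v)
    → QuasiEulerian H
      × Σ (Fin k → Family H) (λ 𝓕 →
          ((i : Fin k) → IsEulerFamily H (𝓕 i))
          × ((f : Vertex H × Edge H) → IsFlag H f →
              Σ (Fin k) (λ i → IsAnchorFlagOf H f (𝓕 i)
                × ((j : Fin k) → IsAnchorFlagOf H f (𝓕 j) → j ≡ i))))
mainTheorem10 k k≥1 H uniform evenDegrees =
  (𝓕 (fromℕ< k≥1) , isEulerFamily (fromℕ< k≥1)) , 𝓕 , isEulerFamily , partition
  where
    open ColouredEulerFamilies k H uniform evenDegrees

    partition : (f : Vertex H × Edge H) → IsFlag H f →
      Σ (Fin k) λ i → IsAnchorFlagOf H f (𝓕 i) × ((j : Fin k) → IsAnchorFlagOf H f (𝓕 j) → j ≡ i)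
    partition f flag = let i , f∈i = colourOf flag in
      i , colourFlag⇒anchorFlag i f∈i , λ j anchor → colourOf-unique i j f∈i (anchorFlag⇒colourFlag j anchor)
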